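{- Let $G$ be a graph of girth at least $5$ and let $\mathcal{H}=\bigcup_{i\in[t]}\bigcup_{j\in[\ell_i]}P_{i,j}$ be a maximal coarse ear-decomposition in $G$. Then $\mathcal{H}$ is an induced subgraph of $G$.
   Context: Graphs are finite and simple; $[i]=\{1,\dots,i\}$. For $S\subseteq V(G)$ and $r\ge0$, $B_G(S,r)$ is the set of vertices at distance at most $r$ from $S$ in $G$. $V_{\ge3}(G)$ is the set of vertices of degree at least $3$ in $G$. For a subgraph $H$ of $G$, an $H$-path is a path in $G$ of length at least $1$ whose ends lie in $V(H)$, whose internal vertices are not in $V(H)$, and which shares no edge with $H$. Coarse ear-decomposition: for positive integers $t,\ell_1,\dots,\ell_t$, a subgraph $\mathcal{H}=\bigcup_{i\in[t]}\bigcup_{j\in[\ell_i]}P_{i,j}$ of $G$ such that, with $H_{0,0}$ the null graph, $\ell_0=0$, $Y_{0,0}=Z_{0,0}=\emptyset$, and for $i\in[t],j\in[\ell_i]$: $H_{i,j}=\bigl(\bigcup_{p\in[i-1]}\bigcup_{q\in[\ell_p]}P_{p,q}\bigr)\cup\bigcup_{r\in[j]}P_{i,r}$, $Y_{i,j}=B_{H_{i,j}}(V_{\ge3}(H_{i,j}),2)$, $Z_{i,j}=B_{G-(V(H_{i,j})\setminus Y_{i,j})}(Y_{i,j},1)$, the following hold. (A) For each $i\in[t]$, $G-Z_{i-1,\ell_{i-1}}$ has no $H_{i-1,\ell_{i-1}}$-path. (B) For each $i\in[t]$: if $G-Z_{i-1,\ell_{i-1}}$ has a cycle meeting $V(H_{i-1,\ell_{i-1}})$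 in exactly one vertex, then $P_{i,1}$ is a shortest such cycle (type 1), and $c_i$ denotes that vertex; otherwise $P_{i,1}$ is a shortest cycle of $G-Z_{i-1,\ell_{i-1}}$ (type 2). (C) For each $i\in[t]$ and $j\in[\ell_i]\setminus\{1\}$, $P_{i,j}$ is a shortest $H_{i,j-1}$-path of $G-Z_{i,j-1}$, with ends $a_{i,j},b_{i,j}$. $\mathcal{H}$ is maximal if $G$ has no coarse ear-decomposition containing $\mathcal{H}$ as a proper subgraph. -}

module Defs where

open import Data.Nat using (ℕ; zero; suc; _≤_; _∸_)
open import Data.Fin using (Fin)
open import Data.List using (List; []; _∷_; _++_; [_]; length)
open import Data.List.Membership.Propositional using (_∈_; _∉_)
open import Data.List.Relation.Unary.All using (All)
open import Data.List.Relation.Unary.Unique.Propositional using (Unique)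
open import Data.Product using (Σ; _×_; _,_; ∃; ∃-syntax)
open import Data.Sum using (_⊎_)
open import Data.Unit using (⊤)
open import Data.Empty using (⊥)
open import Relation.Nullary using (¬_)
open import Relation.Binary.PropositionalEquality using (_≡_; _≢_)

record Graph (n : ℕ) : Set₁ where
  field
    Adj    : Fin n → Fin n → Set
    sym    : ∀ {x y} → Adj x y → Adj y x
    irrefl : ∀ {x} → ¬ Adj x x
open Graph public

module _ {n : ℕ} where

  V : Set
  V = Fin n

  Consec : List V → V → V → Set
  Consec xs x y = Σ (List V) λ as → Σ (List V) λ bs → xs ≡ as ++ x ∷ y ∷ bs

  ConsecAdj : Graph n → List V → Set
  ConsecAdj G xs = ∀ x y → Consec xs x y → Adj G x y

  IsPath : Graph n → List V → Set
  IsPath G xs = Unique xs × ConsecAdj G xs × (2 ≤ length xs)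

  -- A cycle v0 v1 ... vk is represented by the closed list
  -- v0 ∷ v1 ∷ ... ∷ vk ∷ [ v0 ], with v0 ... vk distinct and k ≥ 2.
  IsCycle : Graph n → List V → Set
  IsCycle G xs = Σ V λ v → Σ (List V) λ zs →
    (xs ≡ v ∷ zs ++ [ v ]) × Unique (v ∷ zs) × (2 ≤ length zs) × ConsecAdj G xs

  len : List V → ℕ
  len xs = length xs ∸ 1

  IsPathAvoid : Graph n → (V → Set) → List V → Set
  IsPathAvoid G X xs = IsPath G xs × All (λ v → ¬ X v) xs

  IsCycleAvoid : Graph n → (V → Set) → List V → Set
  IsCycleAvoid G X xs = IsCycle G xs × All (λ v → ¬ X v) xs

  Shortest : (List V → Set) → List V → Set
  Shortest S P = S P × (∀ Q → S Q → len P ≤ len Q)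

  -- Subgraphs given as unions of pieces (paths and cycles, each a list
  -- of vertices; the edges of a piece are its consecutive pairs).

  Pieces : Set
  Pieces = List (List V)

  VH : Pieces → V → Set
  VH H x = Σ (List V) λ p → (p ∈ H) × (x ∈ p)

  EH : Pieces → V → V → Set
  EH H x y = Σ (List V) λ p → (p ∈ H) × (Consec p x y ⊎ Consec p y x)

  -- ball of radius r around S in the graph with vertex set W and edge set E
  data Walk (W : V → Set) (E : V → V → Set) : ℕ → V → V → Set where
    here : ∀ {r x} → W x → Walk W E r x x
    step : ∀ {r x y z} → W x → E x y → Walk W E r y z → Walk W E (suc r) x z

  Ball : (V → Set) → (V → V → Set) → (V → Set) → ℕ → V → Set
  Ball W E S r x = Σ V λ s → S s × Walk W E r s x

  Deg3 : Pieces → V → Set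
  Deg3 H x = Σ V λ a → Σ V λ b → Σ V λ c →
    a ≢ b × a ≢ c × b ≢ c × EH H x a × EH H x b × EH H x c

  Yset : Pieces → V → Set
  Yset H = Ball (VH H) (EH H) (Deg3 H) 2

  -- Z(H) = B_{G − (V(H) \ Y(H))}(Y(H), 1)
  Zset : Graph n → Pieces → V → Set
  Zset G H = Ball (λ x → ¬ (VH H x × ¬ Yset H x)) (Adj G) (Yset H) 1

  IsHPath : Graph n → (V → Set) → Pieces → List V → Set
  IsHPath G X H P =
    IsPathAvoid G X P ×
    (Σ V λ a → Σ V λ b → Σ (List V) λ mid →
       (P ≡ a ∷ mid ++ [ b ]) × VH H a × VH H b × All (λ v → ¬ VH H v) mid) ×
    (∀ x y → Consec P x y → ¬ EH H x y)

  OneMeetCycle : Graph n → (V → Set) → Pieces → List V → Set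
  OneMeetCycle G X H C = IsCycleAvoid G X C ×
    (Σ V λ c → c ∈ C × VH H c × (∀ v → v ∈ C → VH H v → v ≡ c))

  -- Coarse ear-decompositions. A stage i is a pair (P_{i,1}, [P_{i,2},…,P_{i,ℓ_i}]).

  Stage : Set
  Stage = List V × List (List V)

  -- condition (C) for the ears P_{i,2},…, given the current H_{i,j-1}
  ValidEars : Graph n → Pieces → List (List V) → Set
  ValidEars G H [] = ⊤
  ValidEars G H (P ∷ Ps) =
    Shortest (IsHPath G (Zset G H) H) P × ValidEars G (H ++ [ P ]) Ps

  -- condition (B) for P_{i,1}, given H = H_{i-1,ℓ_{i-1}}
  FirstEar : Graph n → Pieces → List V → Set
  FirstEar G H C =
    ((Σ (List V) (OneMeetCycle G (Zset G H) H)) →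
        Shortest (OneMeetCycle G (Zset G H) H) C) ×
    (¬ (Σ (List V) (OneMeetCycle G (Zset G H) H)) →
        Shortest (IsCycleAvoid G (Zset G H)) C)

  ValidStages : Graph n → Pieces → List Stage → Set
  ValidStages G H [] = ⊤
  ValidStages G H ((C , Ps) ∷ rest) =
    (¬ Σ (List V) (IsHPath G (Zset G H) H)) ×
    FirstEar G H C ×
    ValidEars G (H ++ [ C ]) Ps ×
    ValidStages G (H ++ C ∷ Ps) rest

  piecesOf : List Stage → Pieces
  piecesOf [] = []
  piecesOf ((C , Ps) ∷ rest) = (C ∷ Ps) ++ piecesOf rest

  -- D is a coarse ear-decomposition of G (t ≥ 1, starting from the null graph)
  IsCED : Graph n → List Stage → Set
  IsCED G [] = ⊥
  IsCED G (S ∷ Ss) = ValidStages G [] (S ∷ Ss)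

  _⊆H_ : Pieces → Pieces → Set
  H ⊆H H' = (∀ x → VH H x → VH H' x) × (∀ x y → EH H x y → EH H' x y)

  IsMaximalCED : Graph n → List Stage → Set
  IsMaximalCED G D = IsCED G D ×
    ¬ (Σ (List Stage) λ D' → IsCED G D' ×
         (piecesOf D ⊆H piecesOf D') × ¬ (piecesOf D' ⊆H piecesOf D))

  GirthAtLeast : Graph n → ℕ → Set
  GirthAtLeast G k = ∀ C → IsCycle G C → k ≤ len C

  Induced : Graph n → Pieces → Set
  Induced G H = ∀ x y → VH H x → VH H y → Adj G x y → EH H x y

{-# OPTIONS --safe #-}

-- Call H tame if every vertex of H has two H-neighbours, no vertex outside V(H) ∪ Z(H) has
-- three neighbours in V(H) ∖ Z(H), and H has at most one chord (an edge of G between vertices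
-- of H that is not an edge of H), whose ends lie outside Z(H).  For G of girth at least 5 every
-- step of a coarse ear-decomposition preserves tameness: a chord or a claw created by the new
-- ear would give a shorter H-path, or for the first ear of a stage a shorter admissible cycle,
-- than the one chosen, or else a cycle of length at most 4.  Shorter H-paths are found as
-- walks: a walk of G − Z(H) without edges of H between two vertices of H contains an H-path
-- no longer than itself (cut it where it first returns to H, then erase its loops).
-- Finally, a chord xy of a maximal decomposition has both ends outside Z(H), so the edge xy
-- would be a shortest H-path of G − Z(H) that could be appended as a further ear.

module Submission where

open import Defs renaming (sym to adj-sym)
open import Data.Empty using (⊥; ⊥-elim)
open import Data.Fin using (Fin)
open import Data.Fin.Properties using (_≟_)
open import Data.List using (List; []; _∷_; _++_; [_]; length)
open import Data.List.Properties using (++-assoc; ++-identityʳ; length-++; length-++-comm; length-++-≤ʳ; ∷-injective)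
open import Data.List.Membership.Propositional using (_∈_; _∉_; find; lose)
open import Data.List.Membership.Propositional.Properties using (∈-++⁺ˡ; ∈-++⁺ʳ; ∈-++⁻; ∈-∃++)
open import Data.List.Relation.Binary.Disjoint.Propositional using (Disjoint)
open import Data.List.Relation.Binary.Sublist.Propositional using (_⊆_; []; _∷_; _∷ʳ_; ⊆-refl; ⊆-trans; minimum)
open import Data.List.Relation.Binary.Sublist.Propositional.Properties using (Any-resp-⊆; length-mono-≤)
import Data.List.Relation.Binary.Sublist.Propositional.Properties as Sublist
open import Data.List.Relation.Binary.Subset.Propositional using () renaming (_⊆_ to _⊑_)
open import Data.List.Relation.Binary.Subset.Propositional.Properties using (xs⊆xs++ys)
open import Data.List.Relation.Unary.All as All using (All; []; _∷_)
open import Data.List.Relation.Unary.All.Properties using (¬Any⇒All¬)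
import Data.List.Relation.Unary.All.Properties as Allₚ
open import Data.List.Relation.Unary.Any using (Any; here; there; any?)
open import Data.List.Relation.Unary.AllPairs as AllPairs using ([]; _∷_)
open import Data.List.Relation.Unary.Linked as Linked using (Linked; []; [-]; _∷_)
open import Data.List.Relation.Unary.Unique.Propositional using (Unique)
import Data.List.Relation.Unary.Unique.Propositional.Properties as Unique
open import Data.Nat using (ℕ; suc; _+_; _≤_; _<_; z≤n; s≤s; s≤s⁻¹)
open import Data.Nat.Properties using (≤-trans; <⇒≱; +-cancelʳ-≤; +-monoʳ-<)
open import Data.Product using (Σ; ∃; ∃₂; _×_; _,_; proj₁; proj₂; map₁)
open import Data.Sum using (_⊎_; inj₁; inj₂; [_,_]′)
open import Function using (_∘_)
open import Relation.Binary.Definitions using (DecidableEquality)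
open import Relation.Nullary using (¬_; Dec; yes; no; ¬?)
open import Relation.Nullary.Decidable using (map′; _×-dec_; _⊎-dec_)
open import Relation.Binary.PropositionalEquality using (_≡_; _≢_; refl; sym; trans; cong; subst; subst₂)

private
  variable
    A : Set
    R : A → A → Set
    a b c p s t u v w x y x′ y′ : A
    xs ys zs ws M₁ M₂ S T T′ : List A
    n : ℕ
    H K : Pieces {n}
    ear : List (Fin n)
    Ps : List (List (Fin n))
    D : List (Stage {n})

Unique-++⁻ˡ : ∀ xs → Unique (xs ++ ys) → Unique xs
Unique-++⁻ˡ []       _        = []
Unique-++⁻ˡ (x ∷ xs) (x∉ ∷ u) = Allₚ.++⁻ˡ xs x∉ ∷ Unique-++⁻ˡ xs u

Unique-++⁻ʳ : ∀ xs → Unique (xs ++ ys) → Unique ys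
Unique-++⁻ʳ []       u       = u
Unique-++⁻ʳ (x ∷ xs) (_ ∷ u) = Unique-++⁻ʳ xs u

Unique-++-disjoint : ∀ xs → Unique (xs ++ ys) → Disjoint xs ys
Unique-++-disjoint (x ∷ xs) (x∉ ∷ _) (here refl , v∈) = All.lookup (Allₚ.++⁻ʳ xs x∉) v∈ refl
Unique-++-disjoint (x ∷ xs) (_ ∷ u)  (there v∈ , w∈) = Unique-++-disjoint xs u (v∈ , w∈)

Unique-++-comm : ∀ xs → Unique (xs ++ ys) → Unique (ys ++ xs)
Unique-++-comm xs u =
  Unique.++⁺ (Unique-++⁻ʳ xs u) (Unique-++⁻ˡ xs u) (λ (p , q) → Unique-++-disjoint xs u (q , p))

length-∷ʳ : ∀ xs → length (xs ++ [ x ]) ≡ suc (length xs)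
length-∷ʳ xs = length-++-comm xs _

2≤length : ∀ (m : List A) → 2 ≤ length (a ∷ m ++ [ b ])
2≤length m = s≤s (subst (1 ≤_) (sym (length-∷ʳ m)) (s≤s z≤n))

++-length-≤ : ∀ (xs : List A) → length (xs ++ ys) ≤ length ys → xs ≡ []
++-length-≤ []       _  = refl
++-length-≤ (_ ∷ xs) le = ⊥-elim (<⇒≱ le (length-++-≤ʳ _ {xs}))

∷ʳ-length-≤1 : ∀ (xs : List A) → length (xs ++ [ b ]) ≤ 1 → xs ≡ []
∷ʳ-length-≤1 []          _        = refl
∷ʳ-length-≤1 (_ ∷ [])    (s≤s ())
∷ʳ-length-≤1 (_ ∷ _ ∷ _) (s≤s ())

∷ʳ-length-≤2 : ∀ (xs : List A) → length (xs ++ [ b ]) ≤ 2 → x ∈ xs → xs ≡ [ x ]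
∷ʳ-length-≤2 []              _              ()
∷ʳ-length-≤2 (_ ∷ [])        _              (here refl) = refl
∷ʳ-length-≤2 (_ ∷ [])        _              (there ())
∷ʳ-length-≤2 (_ ∷ _ ∷ [])    (s≤s (s≤s ())) _
∷ʳ-length-≤2 (_ ∷ _ ∷ _ ∷ _) (s≤s (s≤s ())) _

prefix-length-≤ : ∀ (xs : List A) → length (xs ++ y ∷ ys ++ [ b ]) ≤ length (xs ++ y ∷ [ c ]) → ys ≡ []
prefix-length-≤ {ys = ys} [] (s≤s le) = ∷ʳ-length-≤1 ys le
prefix-length-≤ {y = y} {ys = ys} {b = b} {c = c} (_ ∷ xs) (s≤s le) =
  prefix-length-≤ {y = y} {ys = ys} {b = b} {c = c} xs le

infix-length-≤ : ∀ (xs : List A) → length (xs ++ y ∷ M₁ ++ zs) ≤ length (xs ++ y ∷ M₂ ++ zs) →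
                 length M₁ ≤ length M₂
infix-length-≤ {M₁ = M₁} {zs = zs} {M₂ = M₂} [] (s≤s le)
  rewrite length-++ M₁ {zs} | length-++ M₂ {zs} = +-cancelʳ-≤ (length zs) (length M₁) (length M₂) le
infix-length-≤ {y = y} {M₁ = M₁} {zs = zs} {M₂ = M₂} (_ ∷ xs) (s≤s le) =
  infix-length-≤ {y = y} {M₁ = M₁} {zs = zs} {M₂ = M₂} xs le

arc-shorter : ∀ (xs : List A) → length ys < length zs →
              length (x ∷ xs ++ y ∷ ys) < length (x ∷ xs) + length (y ∷ zs)
arc-shorter {zs = zs} xs lt =
  subst (_< suc (length xs + suc (length zs))) (cong suc (sym (length-++ xs)))
        (s≤s (+-monoʳ-< (length xs) (s≤s lt)))

++-≢-[] : ∀ xs → xs ++ x ∷ ys ≢ []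
++-≢-[] []      ()
++-≢-[] (_ ∷ _) ()

init-last : ∀ x xs → ∃₂ λ (I : List A) l → x ∷ xs ≡ I ++ [ l ]
init-last x []       = [] , x , refl
init-last x (y ∷ xs) with init-last y xs
... | I , l , eq = x ∷ I , l , cong (x ∷_) eq

∷ʳ-cons : ∀ (xs : List A) → ∃₂ λ s ys → xs ++ [ b ] ≡ s ∷ ys
∷ʳ-cons []       = _ , [] , refl
∷ʳ-cons (x ∷ xs) = x , xs ++ [ _ ] , refl

snoc-split : xs ≡ M₁ ++ y ∷ M₂ → xs ++ [ b ] ≡ M₁ ++ y ∷ M₂ ++ [ b ]
snoc-split {M₁ = M₁} refl = ++-assoc M₁ _ _

snoc-split₂ : xs ≡ M₁ ++ u ∷ S ++ v ∷ M₂ → xs ++ [ b ] ≡ M₁ ++ u ∷ S ++ v ∷ M₂ ++ [ b ]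
snoc-split₂ {M₁ = M₁} {u = u} {S = S} eq =
  trans (snoc-split eq) (cong (λ L → M₁ ++ u ∷ L) (snoc-split {M₁ = S} refl))

∈-++-∷⁻ : ∀ xs → v ∈ xs ++ y ∷ ys → v ∈ xs ++ [ y ] ⊎ v ∈ ys
∈-++-∷⁻ {y = y} {ys = ys} xs v∈ = ∈-++⁻ (xs ++ [ y ]) (subst (_ ∈_) (sym (++-assoc xs [ y ] ys)) v∈)

∈-∃++₂ : x ∈ xs → y ∈ xs → x ≢ y →
         (∃₂ λ B S → ∃ λ C → xs ≡ B ++ x ∷ S ++ y ∷ C) ⊎
         (∃₂ λ B S → ∃ λ C → xs ≡ B ++ y ∷ S ++ x ∷ C)
∈-∃++₂ (here refl) (here refl) x≢y = ⊥-elim (x≢y refl)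
∈-∃++₂ (here refl) (there y∈)  _ with ∈-∃++ y∈
... | S , C , eq = inj₁ ([] , S , C , cong (_ ∷_) eq)
∈-∃++₂ (there x∈)  (here refl) _ with ∈-∃++ x∈
... | S , C , eq = inj₂ ([] , S , C , cong (_ ∷_) eq)
∈-∃++₂ {xs = z ∷ _} (there x∈) (there y∈) x≢y with ∈-∃++₂ x∈ y∈ x≢y
... | inj₁ (B , S , C , eq) = inj₁ (z ∷ B , S , C , cong (z ∷_) eq)
... | inj₂ (B , S , C , eq) = inj₂ (z ∷ B , S , C , cong (z ∷_) eq)

first-split : {P : A → Set} → (∀ v → Dec (P v)) → Any P xs →
              ∃₂ λ I c → ∃ λ J → xs ≡ I ++ c ∷ J × All (λ v → ¬ P v) I × P c
first-split {xs = v ∷ xs} P? any with P? v | any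
... | yes p  | _         = [] , v , xs , refl , [] , p
... | no ¬p  | here p    = ⊥-elim (¬p p)
... | no ¬p  | there any′ with first-split P? any′
...   | I , c , J , eq , ¬I , p = v ∷ I , c , J , cong (v ∷_) eq , ¬p ∷ ¬I , p

Linked-++⁻ : ∀ xs → Linked R (xs ++ x ∷ ys) → Linked R (xs ++ [ x ]) × Linked R (x ∷ ys)
Linked-++⁻ []            l       = [-] , l
Linked-++⁻ (_ ∷ [])      (r ∷ l) = r ∷ [-] , l
Linked-++⁻ (_ ∷ z ∷ xs)  (r ∷ l) = map₁ (r ∷_) (Linked-++⁻ (z ∷ xs) l)

Linked-++⁺ : ∀ xs → Linked R (xs ++ [ x ]) → Linked R (x ∷ ys) → Linked R (xs ++ x ∷ ys)
Linked-++⁺ []           _        l = l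
Linked-++⁺ (_ ∷ [])     (r ∷ _)  l = r ∷ l
Linked-++⁺ (_ ∷ z ∷ xs) (r ∷ l′) l = r ∷ Linked-++⁺ (z ∷ xs) l′ l

TwoDistinct : (A → Set) → Set
TwoDistinct P = ∃₂ λ s t → s ≢ t × P s × P t

pigeonhole₃ : {P Q : A → Set} → a ≢ b → a ≢ c → b ≢ c → P a ⊎ Q a → P b ⊎ Q b → P c ⊎ Q c →
              TwoDistinct P ⊎ TwoDistinct Q
pigeonhole₃ a≢b _   _   (inj₁ pa) (inj₁ pb) _         = inj₁ (_ , _ , a≢b , pa , pb)
pigeonhole₃ _   a≢c _   (inj₁ pa) (inj₂ _)  (inj₁ pc) = inj₁ (_ , _ , a≢c , pa , pc)
pigeonhole₃ _   _   b≢c (inj₂ _)  (inj₁ pb) (inj₁ pc) = inj₁ (_ , _ , b≢c , pb , pc)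
pigeonhole₃ a≢b _   _   (inj₂ qa) (inj₂ qb) _         = inj₂ (_ , _ , a≢b , qa , qb)
pigeonhole₃ _   a≢c _   (inj₂ qa) (inj₁ _)  (inj₂ qc) = inj₂ (_ , _ , a≢c , qa , qc)
pigeonhole₃ _   _   b≢c (inj₁ _)  (inj₂ qb) (inj₂ qc) = inj₂ (_ , _ , b≢c , qb , qc)

-- Loop erasure

_EndsWith_ : List A → A → Set
xs EndsWith c = ∃ λ I → xs ≡ I ++ [ c ]

EndsWith-suffix : ∀ B → (B ++ x ∷ ys) EndsWith c → (x ∷ ys) EndsWith c
EndsWith-suffix []      e             = e
EndsWith-suffix (_ ∷ B) ([] , eq)     = ⊥-elim (++-≢-[] B (proj₂ (∷-injective eq)))
EndsWith-suffix (_ ∷ B) (_ ∷ I , eq)  = EndsWith-suffix B (I , proj₂ (∷-injective eq))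

EndsWith-tail : (x ∷ ys) EndsWith c → x ≢ c → ys EndsWith c
EndsWith-tail ([] , eq)    x≢c = ⊥-elim (x≢c (proj₁ (∷-injective eq)))
EndsWith-tail (_ ∷ I , eq) _   = I , proj₂ (∷-injective eq)

erase-loops : {A : Set} {R : A → A → Set} {x c : A} {ws : List A} →
              DecidableEquality A → Linked R (x ∷ ws) → (x ∷ ws) EndsWith c →
              ∃ λ ys → ys ⊆ ws × Unique (x ∷ ys) × Linked R (x ∷ ys) × (x ∷ ys) EndsWith c
erase-loops {ws = []} _≟ₐ_ _ e = [] , [] , [] ∷ [] , [-] , e
erase-loops {x = x} {ws = w ∷ ws} _≟ₐ_ (r ∷ l) e with erase-loops _≟ₐ_ l (EndsWith-suffix (x ∷ []) e)
... | ys , ys⊆ , u , l′ , (I , eq′) with any? (x ≟ₐ_) (w ∷ ys)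
...   | no x∉ = w ∷ ys , refl ∷ ys⊆ , ¬Any⇒All¬ _ x∉ ∷ u , r ∷ l′ , (x ∷ I , cong (x ∷_) eq′)
...   | yes x∈ with ∈-∃++ x∈
...     | B , C , eq =
  C , ⊆-trans (subst (C ⊆_) (sym eq) (Sublist.++⁺ˡ B (x ∷ʳ ⊆-refl))) (refl ∷ ys⊆) ,
  Unique-++⁻ʳ B (subst Unique eq u) ,
  proj₂ (Linked-++⁻ B (subst (Linked _) eq l′)) ,
  EndsWith-suffix B (subst (_EndsWith _) eq (I , eq′))

-- Cyclic lists

-- A cycle v₀ v₁ … v_k is handled through the list r = v₀ ∷ … ∷ v_k; Defs represents it as closed r.

Rotation : List A → List A → Set
Rotation xs ys = ∃₂ λ B C → xs ≡ B ++ C × ys ≡ C ++ B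

rotation-sym : Rotation xs ys → Rotation ys xs
rotation-sym (B , C , p , q) = C , B , q , p

++-≡-++ : ∀ (B : List A) {C D E} → B ++ C ≡ D ++ E →
          ∃ λ M → (D ≡ B ++ M × C ≡ M ++ E) ⊎ (B ≡ D ++ M × E ≡ M ++ C)
++-≡-++ []      {D = D}     eq = D , inj₁ (refl , eq)
++-≡-++ (b ∷ B) {D = []}    eq = b ∷ B , inj₂ (refl , sym eq)
++-≡-++ (b ∷ B) {D = d ∷ D} eq with ∷-injective eq
... | refl , eq′ with ++-≡-++ B eq′
...   | M , inj₁ (p , q) = M , inj₁ (cong (b ∷_) p , q)
...   | M , inj₂ (p , q) = M , inj₂ (cong (b ∷_) p , q)

rotation-trans : Rotation xs ys → Rotation ys zs → Rotation xs zs
rotation-trans (B , C , refl , refl) (D , E , eq , refl) with ++-≡-++ C {C = B} {D = D} {E = E} eq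
... | M , inj₁ (refl , refl) = M , E ++ C , ++-assoc M E C , sym (++-assoc E C M)
... | M , inj₂ (refl , refl) = B ++ D , M , sym (++-assoc B D M) , ++-assoc M B D

rotation-∈ : Rotation xs ys → x ∈ xs → x ∈ ys
rotation-∈ (B , C , refl , refl) x∈ with ∈-++⁻ B x∈
... | inj₁ x∈B = ∈-++⁺ʳ C x∈B
... | inj₂ x∈C = ∈-++⁺ˡ x∈C

rotation-unique : Rotation xs ys → Unique xs → Unique ys
rotation-unique (B , _ , refl , refl) = Unique-++-comm B

rotation-length : Rotation xs ys → length xs ≡ length ys
rotation-length (B , C , refl , refl) = length-++-comm B C

closed : List A → List A
closed []       = []
closed (x ∷ xs) = x ∷ xs ++ [ x ]

rotation-closed : Rotation xs ys → Linked R (closed xs) → Linked R (closed ys)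
rotation-closed {R = R} ([] , C , refl , refl) l = subst (Linked R ∘ closed) (sym (++-identityʳ C)) l
rotation-closed {R = R} (B@(_ ∷ _) , [] , refl , refl) l = subst (Linked R ∘ closed) (++-identityʳ B) l
rotation-closed (b ∷ B , c ∷ C , refl , refl) l
  with Linked-++⁻ (b ∷ B) (subst (λ L → Linked _ (b ∷ L)) (++-assoc B (c ∷ C) [ b ]) l)
... | b…c , c…b =
  subst (λ L → Linked _ (c ∷ L)) (sym (++-assoc C (b ∷ B) [ c ])) (Linked-++⁺ (c ∷ C) c…b b…c)

rotate-to : x ∈ xs → ∃ λ zs → Rotation xs (x ∷ zs)
rotate-to x∈ with ∈-∃++ x∈
... | B , C , eq = C ++ B , B , _ ∷ C , eq , refl

rotate-∷ʳ : Rotation (x ∷ xs) (xs ++ [ x ])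
rotate-∷ʳ {x = x} {xs = xs} = [ x ] , xs , refl , refl

∈-closed⁺ : ∀ {r : List A} → v ∈ r → v ∈ closed r
∈-closed⁺ (here refl) = here refl
∈-closed⁺ (there v∈)  = there (∈-++⁺ˡ v∈)

∈-closed⁻ : ∀ {r : List A} → v ∈ closed r → v ∈ r
∈-closed⁻ {r = _ ∷ _} (here refl) = here refl
∈-closed⁻ {r = _ ∷ _} (there v∈)  = rotation-∈ (rotation-sym rotate-∷ʳ) v∈

ring-path : ∀ {r : List A} → x ∈ r → y ∈ r → Linked R (closed r) →
            ∃ λ I → Linked R (x ∷ I ++ [ y ]) × (∀ {v} → v ∈ I → v ∈ r)
ring-path {x = x} x∈ y∈ l with rotate-to x∈
... | zs , rot with ∈-∃++ (rotation-∈ rotate-∷ʳ (rotation-∈ rot y∈))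
... | I , J , eq =
  I , proj₁ (Linked-++⁻ (x ∷ I) (subst (Linked _ ∘ (x ∷_)) eq (rotation-closed rot l))) ,
  λ v∈ → rotation-∈ (rotation-sym rot)
           (rotation-∈ (rotation-sym rotate-∷ʳ) (subst (_ ∈_) (sym eq) (∈-++⁺ˡ v∈)))

record Arcs (r : List A) (x y : A) : Set where
  constructor arcs
  field
    inner₁ inner₂ : List A
    rotation : Rotation r (x ∷ inner₁ ++ y ∷ inner₂)

find-arcs : ∀ {r} → x ∈ r → y ∈ r → x ≢ y → Arcs r x y
find-arcs {x = x} {r = r} x∈ y∈ x≢y with rotate-to x∈
... | zs , rot with rotation-∈ rot y∈
...   | here y≡x = ⊥-elim (x≢y (sym y≡x))
...   | there y∈zs with ∈-∃++ y∈zs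
...     | S₁ , S₂ , eq = arcs S₁ S₂ (subst (Rotation r ∘ (x ∷_)) eq rot)

arcs-swap : ∀ {r} → Arcs r x y → Arcs r y x
arcs-swap {x = x} {y = y} (arcs S₁ S₂ rot) = arcs S₂ S₁ (rotation-trans rot (x ∷ S₁ , y ∷ S₂ , refl , refl))

module _ {r : List A} {x y : A} (α : Arcs r x y) where
  open Arcs α

  private
    rotation′ : Rotation r ((x ∷ inner₁ ++ [ y ]) ++ inner₂)
    rotation′ = subst (Rotation r ∘ (x ∷_)) (sym (++-assoc inner₁ [ y ] inner₂)) rotation

  arc-linked : Linked R (closed r) → Linked R (x ∷ inner₁ ++ [ y ])
  arc-linked l = proj₁ (Linked-++⁻ (x ∷ inner₁)
    (subst (λ L → Linked _ (x ∷ L)) (++-assoc inner₁ (y ∷ inner₂) [ x ]) (rotation-closed rotation l)))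

  arc-unique : Unique r → Unique (x ∷ inner₁ ++ [ y ])
  arc-unique u = Unique-++⁻ˡ (x ∷ inner₁ ++ [ y ]) (rotation-unique rotation′ u)

  arc-⊆ : v ∈ x ∷ inner₁ ++ [ y ] → v ∈ r
  arc-⊆ v∈ = rotation-∈ (rotation-sym rotation′) (∈-++⁺ˡ v∈)

  arcs-cover : v ∈ r → v ∈ x ∷ inner₁ ⊎ v ∈ y ∷ inner₂
  arcs-cover v∈ = ∈-++⁻ (x ∷ inner₁) (rotation-∈ rotation v∈)

  arcs-length : length r ≡ length (x ∷ inner₁) + length (y ∷ inner₂)
  arcs-length = trans (rotation-length rotation) (length-++ (x ∷ inner₁))

Consec-[] : ¬ Consec [] x y
Consec-[] (as , _ , eq) = ++-≢-[] as (sym eq)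

Consec-∷⁺ : Consec xs x y → Consec (v ∷ xs) x y
Consec-∷⁺ (as , bs , eq) = _ ∷ as , bs , cong (_ ∷_) eq

Consec-∷⁻ : Consec (v ∷ xs) x y → (v ≡ x × ∃ λ bs → xs ≡ y ∷ bs) ⊎ Consec xs x y
Consec-∷⁻ ([] , bs , refl)    = inj₁ (refl , bs , refl)
Consec-∷⁻ (_ ∷ as , bs , eq) = inj₂ (as , bs , proj₂ (∷-injective eq))

Consec-[-] : ¬ Consec (v ∷ []) x y
Consec-[-] c = [ (λ { (_ , _ , ()) }) , Consec-[] ]′ (Consec-∷⁻ c)

Consec-∈ : Consec xs x y → x ∈ xs × y ∈ xs
Consec-∈ (as , _ , refl) = ∈-++⁺ʳ as (here refl) , ∈-++⁺ʳ as (there (here refl))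

Consec-∷ʳ-∈ : ∀ (ys : List (Fin n)) → Consec (ys ++ [ v ]) x y → x ∈ ys
Consec-∷ʳ-∈ []       c = ⊥-elim (Consec-[-] c)
Consec-∷ʳ-∈ (_ ∷ ys) c with Consec-∷⁻ c
... | inj₁ (refl , _) = here refl
... | inj₂ c′         = there (Consec-∷ʳ-∈ ys c′)

Consec-tail-∈ : Consec (v ∷ ys) x y → y ∈ ys
Consec-tail-∈ c with Consec-∷⁻ c
... | inj₁ (_ , _ , refl) = here refl
... | inj₂ c′             = proj₂ (Consec-∈ c′)

Consec? : (xs : List (Fin n)) (x y : Fin n) → Dec (Consec xs x y)
Consec? []           x y = no Consec-[]
Consec? (v ∷ [])     x y = no Consec-[-]
Consec? (v ∷ w ∷ xs) x y =
  map′ from to ((v ≟ x ×-dec w ≟ y) ⊎-dec Consec? (w ∷ xs) x y)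
  where
    from : (v ≡ x × w ≡ y) ⊎ Consec (w ∷ xs) x y → Consec (v ∷ w ∷ xs) x y
    from (inj₁ (refl , refl)) = [] , xs , refl
    from (inj₂ c)             = Consec-∷⁺ c
    to : Consec (v ∷ w ∷ xs) x y → (v ≡ x × w ≡ y) ⊎ Consec (w ∷ xs) x y
    to c with Consec-∷⁻ c
    ... | inj₁ (v≡x , _ , eq) = inj₁ (v≡x , proj₁ (∷-injective eq))
    ... | inj₂ c′             = inj₂ c′

Linked⇒Consec : Linked R xs → Consec xs x y → R x y
Linked⇒Consec l ([] , _ , refl)     = Linked.head l
Linked⇒Consec l (_ ∷ as , bs , refl) = Linked⇒Consec (Linked.tail l) (as , bs , refl)

Consec⇒Linked : ∀ (xs : List (Fin n)) → (∀ x y → Consec xs x y → R x y) → Linked R xs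
Consec⇒Linked []           _ = []
Consec⇒Linked (x ∷ [])     _ = [-]
Consec⇒Linked (x ∷ y ∷ xs) f =
  f x y ([] , xs , refl) ∷ Consec⇒Linked (y ∷ xs) (λ u v c → f u v (Consec-∷⁺ c))

Linked-Consec : ∀ (xs : List (Fin n)) → Linked (Consec xs) xs
Linked-Consec xs = Consec⇒Linked xs (λ _ _ c → c)

rotation-Consec : ∀ {r r′ : List (Fin n)} → Rotation r r′ → Consec (closed r′) x y → Consec (closed r) x y
rotation-Consec {r = r} rot = Linked⇒Consec (rotation-closed rot (Linked-Consec (closed r)))

successor-unique : ∀ (ys : List (Fin n)) → Unique ys →
                   Consec (ys ++ [ v ]) x a → Consec (ys ++ [ v ]) x b → a ≡ b
successor-unique []       _          c _ = ⊥-elim (Consec-[-] c)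
successor-unique (_ ∷ ys) (z∉ ∷ u) c c′ with Consec-∷⁻ c | Consec-∷⁻ c′
... | inj₁ (_ , _ , eq) | inj₁ (_ , _ , eq′) = proj₁ (∷-injective (trans (sym eq) eq′))
... | inj₁ (refl , _)   | inj₂ d             = ⊥-elim (All.lookup z∉ (Consec-∷ʳ-∈ ys d) refl)
... | inj₂ d            | inj₁ (refl , _)    = ⊥-elim (All.lookup z∉ (Consec-∷ʳ-∈ ys d) refl)
... | inj₂ d            | inj₂ d′            = successor-unique ys u d d′

predecessor-unique : ∀ (ys : List (Fin n)) → Unique ys →
                     Consec (v ∷ ys) a x → Consec (v ∷ ys) b x → a ≡ b
predecessor-unique []       _          c _ = ⊥-elim (Consec-[-] c)
predecessor-unique (_ ∷ ys) (y∉ ∷ u) c c′ with Consec-∷⁻ c | Consec-∷⁻ c′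
... | inj₁ (refl , _)     | inj₁ (refl , _)     = refl
... | inj₁ (_ , _ , refl) | inj₂ d              = ⊥-elim (All.lookup y∉ (Consec-tail-∈ d) refl)
... | inj₂ d              | inj₁ (_ , _ , refl) = ⊥-elim (All.lookup y∉ (Consec-tail-∈ d) refl)
... | inj₂ d              | inj₂ d′             = predecessor-unique ys u d d′

head-neighbours : ∀ zs → Unique (v ∷ zs) → 2 ≤ length zs →
                  ∃₂ λ s p → s ≢ p × Consec (closed (v ∷ zs)) v s × Consec (closed (v ∷ zs)) p v
head-neighbours (_ ∷ [])     _            (s≤s ())
head-neighbours {v = v} (c ∷ d ∷ zs) (_ ∷ c∉ ∷ _) _ with init-last d zs
... | I , l , eq =
  c , l , (λ c≡l → All.lookup c∉ (subst (l ∈_) (sym eq) (∈-++⁺ʳ I (here refl))) c≡l) ,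
  ([] , d ∷ zs ++ [ v ] , refl) ,
  (v ∷ c ∷ I , [] , cong (λ L → v ∷ c ∷ L) (trans (cong (_++ [ v ]) eq) (++-assoc I [ l ] [ v ])))

ring-neighbours : ∀ {r : List (Fin n)} → Unique r → 3 ≤ length r → v ∈ r →
                  ∃₂ λ s p → s ≢ p × Consec (closed r) v s × Consec (closed r) p v
ring-neighbours u 3≤ v∈ with rotate-to v∈
... | zs , rot with head-neighbours zs (rotation-unique rot u) (s≤s⁻¹ (subst (3 ≤_) (rotation-length rot) 3≤))
... | s , p , s≢p , vs , pv = s , p , s≢p , rotation-Consec rot vs , rotation-Consec rot pv

inner-neighbours : ∀ (a : Fin n) A′ → Unique (a ∷ A′ ++ v ∷ s ∷ ys) →
                   ∃ λ p → p ≢ s × Consec (a ∷ A′ ++ v ∷ s ∷ ys) p v × Consec (a ∷ A′ ++ v ∷ s ∷ ys) v s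
inner-neighbours {v = v} {s = s} {ys = ys} a A′ u with init-last a A′
... | I , p , eq =
  p , (λ p≡s → Unique-++-disjoint (a ∷ A′) u
                 (subst (p ∈_) (sym eq) (∈-++⁺ʳ I (here refl)) , there (here p≡s))) ,
  (I , s ∷ ys , trans (cong (_++ v ∷ s ∷ ys) eq) (++-assoc I [ p ] _)) ,
  (a ∷ A′ , ys , refl)

VH-mono : H ⊑ K → VH H x → VH K x
VH-mono H⊑K (p , p∈ , x∈) = p , H⊑K p∈ , x∈

EH-mono : H ⊑ K → EH H x y → EH K x y
EH-mono H⊑K (p , p∈ , c) = p , H⊑K p∈ , c

EH-sym : EH H x y → EH H y x
EH-sym (p , p∈ , c) = p , p∈ , [ inj₂ , inj₁ ]′ c

EH⇒VH : EH H x y → VH H x × VH H y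
EH⇒VH (p , p∈ , inj₁ c) = (p , p∈ , proj₁ (Consec-∈ c)) , (p , p∈ , proj₂ (Consec-∈ c))
EH⇒VH (p , p∈ , inj₂ c) = (p , p∈ , proj₂ (Consec-∈ c)) , (p , p∈ , proj₁ (Consec-∈ c))

VH-∷ʳ⁺ : x ∈ ear → VH (H ++ [ ear ]) x
VH-∷ʳ⁺ {H = H} x∈ = _ , ∈-++⁺ʳ H (here refl) , x∈

VH-∷ʳ⁻ : VH (H ++ [ ear ]) x → VH H x ⊎ x ∈ ear
VH-∷ʳ⁻ {H = H} (p , p∈ , x∈) with ∈-++⁻ H p∈
... | inj₁ p∈H         = inj₁ (p , p∈H , x∈)
... | inj₂ (here refl) = inj₂ x∈

EH-∷ʳ⁺ : Consec ear x y → EH (H ++ [ ear ]) x y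
EH-∷ʳ⁺ {H = H} c = _ , ∈-++⁺ʳ H (here refl) , inj₁ c

EH-∷ʳ⁻ : EH (H ++ [ ear ]) x y → EH H x y ⊎ (Consec ear x y ⊎ Consec ear y x)
EH-∷ʳ⁻ {H = H} (p , p∈ , c) with ∈-++⁻ H p∈
... | inj₁ p∈H         = inj₁ (p , p∈H , c)
... | inj₂ (here refl) = inj₂ c

VH? : (H : Pieces {n}) (x : Fin n) → Dec (VH H x)
VH? H x = map′ find (λ (p , p∈ , x∈) → lose p∈ x∈) (any? (λ p → any? (x ≟_) p) H)

EH? : (H : Pieces {n}) (x y : Fin n) → Dec (EH H x y)
EH? H x y = map′ find (λ (p , p∈ , c) → lose p∈ c) (any? (λ p → Consec? p x y ⊎-dec Consec? p y x) H)

proper-edge-extension : ∀ {K K′ : Pieces {n}} → K′ ≡ K ++ [ x ∷ [ y ] ] → ¬ EH K x y → (K ⊆H K′) × ¬ (K′ ⊆H K)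
proper-edge-extension {K = K} refl ¬e =
  ((λ _ → VH-mono (xs⊆xs++ys K _)) , (λ _ _ → EH-mono (xs⊆xs++ys K _))) ,
  λ (_ , shrinks) → ¬e (shrinks _ _ (EH-∷ʳ⁺ {H = K} ([] , [] , refl)))

walk-end : {W : Fin n → Set} {E : Fin n → Fin n → Set} {r : ℕ} → Walk W E r x y → W y
walk-end (here w)     = w
walk-end (step _ _ k) = walk-end k

walk-map : {W W′ : Fin n → Set} {E E′ : Fin n → Fin n → Set} {r : ℕ} →
           (∀ {v} → W v → W′ v) → (∀ {u v} → E u v → E′ u v) → Walk W E r x y → Walk W′ E′ r x y
walk-map f g (here w)     = here (f w)
walk-map f g (step w e k) = step (f w) (g e) (walk-map f g k)

Deg3-mono : H ⊑ K → Deg3 H x → Deg3 K x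
Deg3-mono H⊑K (a , b , c , a≢b , a≢c , b≢c , ea , eb , ec) =
  a , b , c , a≢b , a≢c , b≢c , EH-mono H⊑K ea , EH-mono H⊑K eb , EH-mono H⊑K ec

Yset-mono : H ⊑ K → Yset H x → Yset K x
Yset-mono H⊑K (s , d , w) = s , Deg3-mono H⊑K d , walk-map (VH-mono H⊑K) (EH-mono H⊑K) w

Yset⇒VH : Yset H x → VH H x
Yset⇒VH (_ , _ , w) = walk-end w

module _ {n : ℕ} (G : Graph n) where

  Yset⇒Zset : Yset H x → Zset G H x
  Yset⇒Zset y = _ , y , here (λ (_ , ¬y) → ¬y y)

  Zset⇒¬¬Yset : VH H x → Zset G H x → ¬ ¬ Yset H x
  Zset⇒¬¬Yset x∈ (_ , _ , w) ¬y = walk-end w (x∈ , ¬y)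

  Yset-neighbour : Yset H x → Adj G x y → ¬ VH H y → Zset G H y
  Yset-neighbour y xy y∉ = _ , y , step (λ (_ , ¬y) → ¬y y) xy (here (λ (y∈ , _) → y∉ y∈))

  Zset-mono : H ⊑ K → (∀ {v} → VH K v → ¬ VH H v → ¬ Zset G H v) → Zset G H x → Zset G K x
  Zset-mono {H = H} {K = K} {x = x} H⊑K fresh z@(s , y , w) = s , Yset-mono H⊑K y , convert w
    where
      keep : Zset G H v → ¬ (VH H v × ¬ Yset H v) → ¬ (VH K v × ¬ Yset K v)
      keep z out (v∈K , ¬y) = fresh v∈K (λ v∈H → out (v∈H , ¬y ∘ Yset-mono H⊑K)) z
      convert : Walk (λ v → ¬ (VH H v × ¬ Yset H v)) (Adj G) 1 s x →
                Walk (λ v → ¬ (VH K v × ¬ Yset K v)) (Adj G) 1 s x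
      convert (here out)                = here (keep z out)
      convert (step out e (here out′)) = step (keep (Yset⇒Zset y) out) e (here (keep z out′))

  -- H-paths from walks

  Exposed : Pieces → Fin n → Set
  Exposed H v = VH H v × ¬ Zset G H v

  NewEdge : Pieces → Fin n → Fin n → Set
  NewEdge H x y = Adj G x y × ¬ EH H x y

  Chord : Pieces → Fin n → Fin n → Set
  Chord H x y = VH H x × VH H y × NewEdge H x y

  Chord-sym : Chord H x y → Chord H y x
  Chord-sym (x∈ , y∈ , xy , ¬e) = y∈ , x∈ , adj-sym G xy , ¬e ∘ EH-sym

  Adj⇒≢ : Adj G x y → x ≢ y
  Adj⇒≢ xy refl = irrefl G xy

  new-edge : Adj G x y → ¬ VH H x ⊎ ¬ VH H y → NewEdge H x y
  new-edge xy (inj₁ x∉) = xy , λ e → x∉ (proj₁ (EH⇒VH e))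
  new-edge xy (inj₂ y∉) = xy , λ e → y∉ (proj₂ (EH⇒VH e))

  FreeWalk : Pieces → List (Fin n) → Set
  FreeWalk H xs = Linked (NewEdge H) xs × All (λ v → ¬ Zset G H v) xs

  FreeWalk-++⁻ : ∀ xs → FreeWalk H (xs ++ v ∷ ys) → FreeWalk H (xs ++ [ v ]) × FreeWalk H (v ∷ ys)
  FreeWalk-++⁻ xs (l , f) =
    (proj₁ (Linked-++⁻ xs l) , Allₚ.++⁺ (Allₚ.++⁻ˡ xs f) (All.head (Allₚ.++⁻ʳ xs f) ∷ [])) ,
    (proj₂ (Linked-++⁻ xs l) , Allₚ.++⁻ʳ xs f)

  FreeWalk-++⁺ : ∀ xs → FreeWalk H (xs ++ [ v ]) → FreeWalk H (v ∷ ys) → FreeWalk H (xs ++ v ∷ ys)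
  FreeWalk-++⁺ xs (l , f) (l′ , f′) = Linked-++⁺ xs l l′ , Allₚ.++⁺ (Allₚ.++⁻ˡ xs f) f′

  free-edge : NewEdge H x y → ¬ Zset G H x → ¬ Zset G H y → FreeWalk H (x ∷ [ y ])
  free-edge e x-free y-free = e ∷ [-] , x-free ∷ y-free ∷ []

  detour : ¬ VH H w → ¬ Zset G H s → ¬ Zset G H w → ¬ Zset G H t → Adj G w s → Adj G w t →
           FreeWalk H (s ∷ w ∷ [ t ])
  detour w∉ s-free w-free t-free ws wt =
    FreeWalk-++⁺ [ _ ] (free-edge (new-edge (adj-sym G ws) (inj₂ w∉)) s-free w-free)
                       (free-edge (new-edge wt (inj₁ w∉)) w-free t-free)

  hpath-in-walk : VH H a → VH H b → a ≢ b → b ∈ ws → FreeWalk H (a ∷ ws) →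
                  ∃ λ Q → IsHPath G (Zset G H) H Q × len Q ≤ length ws
  hpath-in-walk {H = H} {a = a} {ws = ws} a∈ b∈ a≢b b∈ws (l , free)
    with first-split (λ v → VH? H v ×-dec ¬? (a ≟ v)) (lose b∈ws (b∈ , a≢b))
  ... | I , c , J , refl , ¬I , (c∈ , a≢c)
    with erase-loops _≟_ (proj₁ (Linked-++⁻ (a ∷ I) l)) (a ∷ I , refl)
  ... | ys , ys⊆ , u , l′ , e with EndsWith-tail e a≢c
  ... | m , refl =
    a ∷ m ++ [ c ] ,
    (((u , (λ _ _ → Linked⇒Consec (Linked.map proj₁ l′)) , 2≤length {a = a} m) , All.tabulate Q-free) ,
     (a , c , m , refl , a∈ , c∈ , All.tabulate m-new) ,
     (λ _ _ → Linked⇒Consec (Linked.map proj₂ l′))) ,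
    length-mono-≤ ys⊆ws
    where
      ys⊆ws : m ++ [ c ] ⊆ I ++ c ∷ J
      ys⊆ws = ⊆-trans ys⊆ (Sublist.++⁺ ⊆-refl (refl ∷ minimum J))
      Q-free : v ∈ a ∷ m ++ [ c ] → ¬ Zset G H v
      Q-free (here refl) = All.head free
      Q-free (there v∈)  = All.lookup (All.tail free) (Any-resp-⊆ ys⊆ws v∈)
      m-new : v ∈ m → ¬ VH H v
      m-new v∈m v∈H with ∈-++⁻ I (Any-resp-⊆ ys⊆ (∈-++⁺ˡ v∈m))
      ... | inj₁ v∈I         = All.lookup ¬I v∈I (v∈H , All.lookup (AllPairs.head u) (∈-++⁺ˡ v∈m))
      ... | inj₂ (here refl) = Unique-++-disjoint m (AllPairs.tail u) (v∈m , here refl)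

  new-linked : ∀ xs → Linked (Adj G) (xs ++ [ c ]) → All (λ v → ¬ VH H v) xs → Linked (NewEdge H) (xs ++ [ c ])
  new-linked []           _       _          = [-]
  new-linked (_ ∷ [])     (e ∷ _) (x∉ ∷ _)   = new-edge e (inj₁ x∉) ∷ [-]
  new-linked (_ ∷ y ∷ xs) (e ∷ l) (x∉ ∷ new) = new-edge e (inj₁ x∉) ∷ new-linked (y ∷ xs) l new

  path-cycle : Unique (u ∷ S ++ [ v ]) → Linked (Adj G) (u ∷ S ++ [ v ]) →
               Unique T → (∀ {t} → t ∈ T → t ∉ u ∷ S ++ [ v ]) → Linked (Adj G) (v ∷ T ++ [ u ]) →
               2 ≤ length (S ++ v ∷ T) → IsCycle G (closed (u ∷ S ++ v ∷ T))
  path-cycle {u = u} {S = S} {v = v} {T = T} path-unique path T-unique fresh back 2≤ =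
    u , S ++ v ∷ T , refl ,
    subst Unique (cong (u ∷_) (++-assoc S [ v ] T))
      (Unique.++⁺ path-unique T-unique (λ (p , q) → fresh q p)) ,
    2≤ ,
    (λ _ _ → Linked⇒Consec (subst (Linked (Adj G) ∘ (u ∷_)) (sym (++-assoc S (v ∷ T) [ u ]))
                               (Linked-++⁺ (u ∷ S) path back)))

  len-closed : ∀ (zs : List (Fin n)) → len (closed (v ∷ zs)) ≡ length (v ∷ zs)
  len-closed zs = length-∷ʳ zs

  girth-arc : ∀ (xs : List (Fin n)) → 5 ≤ len (closed (x ∷ xs ++ y ∷ [ w ])) → 2 ≤ length xs
  girth-arc xs 5≤ =
    +-cancelʳ-≤ 2 2 (length xs)
      (subst (4 ≤_) (length-++ xs) (s≤s⁻¹ (subst (5 ≤_) (len-closed (xs ++ _ ∷ [ _ ])) 5≤)))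

  -- Tame subgraphs

  TwoNeighbours : Pieces → Fin n → Set
  TwoNeighbours H v = TwoDistinct (EH H v)

  ExposedNeighbour : Pieces → Fin n → Fin n → Set
  ExposedNeighbour H w t = Exposed H t × Adj G w t

  record Claw (H : Pieces) (w : Fin n) : Set where
    constructor claw
    field
      leaf₁ leaf₂ leaf₃ : Fin n
      distinct₁₂ : leaf₁ ≢ leaf₂
      distinct₁₃ : leaf₁ ≢ leaf₃
      distinct₂₃ : leaf₂ ≢ leaf₃
      at₁ : ExposedNeighbour H w leaf₁
      at₂ : ExposedNeighbour H w leaf₂
      at₃ : ExposedNeighbour H w leaf₃

  claw-map : (∀ {t} → ExposedNeighbour H w t → ExposedNeighbour K w t) → Claw H w → Claw K w
  claw-map f (claw _ _ _ d₁₂ d₁₃ d₂₃ e₁ e₂ e₃) = claw _ _ _ d₁₂ d₁₃ d₂₃ (f e₁) (f e₂) (f e₃)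

  claw-split : {P Q : Fin n → Set} → (∀ {t} → ExposedNeighbour H w t → P t ⊎ Q t) → Claw H w →
               TwoDistinct P ⊎ TwoDistinct Q
  claw-split f (claw _ _ _ d₁₂ d₁₃ d₂₃ e₁ e₂ e₃) = pigeonhole₃ d₁₂ d₁₃ d₂₃ (f e₁) (f e₂) (f e₃)

  SameEdge : Fin n → Fin n → Fin n → Fin n → Set
  SameEdge x y x′ y′ = (x ≡ x′ × y ≡ y′) ⊎ (x ≡ y′ × y ≡ x′)

  -- The double negations make Tame stable under the classical case split in condition (B).
  record Tame (H : Pieces) : Set where
    field
      two-neighbours : VH H v → ¬ ¬ TwoNeighbours H v
      no-claw        : ¬ VH H w → ¬ Zset G H w → ¬ Claw H w
      chord-exposed  : Chord H x y → ¬ Zset G H x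
      chord-unique   : Chord H x y → Chord H x′ y′ → ¬ ¬ SameEdge x y x′ y′

  Tame-stable : ¬ ¬ Tame H → Tame H
  Tame-stable ¬¬tame = record
    { two-neighbours = λ v∈ k → ¬¬tame λ τ → Tame.two-neighbours τ v∈ k
    ; no-claw        = λ w∉ w-free cl → ¬¬tame λ τ → Tame.no-claw τ w∉ w-free cl
    ; chord-exposed  = λ ch z → ¬¬tame λ τ → Tame.chord-exposed τ ch z
    ; chord-unique   = λ ch ch′ k → ¬¬tame λ τ → Tame.chord-unique τ ch ch′ k
    }

  tame-[] : Tame []
  tame-[] = record
    { two-neighbours = λ { (_ , () , _) }
    ; no-claw        = λ { _ _ (claw _ _ _ _ _ _ (((_ , () , _) , _) , _) _ _) }
    ; chord-exposed  = λ { ((_ , () , _) , _) }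
    ; chord-unique   = λ { ((_ , () , _) , _) }
    }

  -- Adding an ear

  module Ear (girth : GirthAtLeast G 5) {H : Pieces} (tame : Tame H) {a b : Fin n} {mid : List (Fin n)}
             (P-unique : Unique (a ∷ mid ++ [ b ]))
             (P-free : FreeWalk H (a ∷ mid ++ [ b ]))
             (a∈H : VH H a) (b∈H : VH H b) (mid-new : All (λ v → ¬ VH H v) mid)
             (P-shortest : ∀ Q → IsHPath G (Zset G H) H Q → length (mid ++ [ b ]) ≤ len Q)
             where

    open Tame tame

    P : List (Fin n)
    P = a ∷ mid ++ [ b ]

    H₂ : Pieces
    H₂ = H ++ [ P ]

    H⊑H₂ : H ⊑ H₂
    H⊑H₂ = xs⊆xs++ys H [ P ]

    a≢b : a ≢ b
    a≢b = All.lookup (AllPairs.head P-unique) (∈-++⁺ʳ mid (here refl))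

    b∈P : b ∈ P
    b∈P = there (∈-++⁺ʳ mid (here refl))

    mid⊆P : v ∈ mid → v ∈ P
    mid⊆P v∈ = there (∈-++⁺ˡ v∈)

    P-free-at : v ∈ P → ¬ Zset G H v
    P-free-at = All.lookup (proj₂ P-free)

    mid-new-at : v ∈ mid → ¬ VH H v
    mid-new-at = All.lookup mid-new

    P-edge : Consec P x y → EH H₂ x y
    P-edge = EH-∷ʳ⁺ {H = H}

    P-new-edge : Consec P x y → NewEdge H x y
    P-new-edge = Linked⇒Consec (proj₁ P-free)

    vertex-kind : VH H₂ v → VH H v ⊎ v ∈ mid
    vertex-kind v∈ with VH-∷ʳ⁻ {H = H} v∈
    ... | inj₁ v∈H         = inj₁ v∈H
    ... | inj₂ (here refl) = inj₁ a∈H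
    ... | inj₂ (there v∈P) with ∈-++⁻ mid v∈P
    ...   | inj₁ v∈mid       = inj₂ v∈mid
    ...   | inj₂ (here refl) = inj₁ b∈H

    Zset-H₂ : Zset G H v → Zset G H₂ v
    Zset-H₂ = Zset-mono H⊑H₂ fresh
      where
        fresh : VH H₂ v → ¬ VH H v → ¬ Zset G H v
        fresh v∈ v∉ with VH-∷ʳ⁻ {H = H} v∈
        ... | inj₁ v∈H = ⊥-elim (v∉ v∈H)
        ... | inj₂ v∈P = P-free-at v∈P

    shortest-walk : VH H x → VH H y → x ≢ y → y ∈ ws → FreeWalk H (x ∷ ws) →
                    length (mid ++ [ b ]) ≤ length ws
    shortest-walk x∈ y∈ x≢y y∈ws walk with hpath-in-walk x∈ y∈ x≢y y∈ws walk
    ... | Q , Q-hpath , Q≤ = ≤-trans (P-shortest Q Q-hpath) Q≤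

    split-at : mid ≡ M₁ ++ y ∷ M₂ → FreeWalk H (a ∷ M₁ ++ [ y ]) × FreeWalk H (y ∷ M₂ ++ [ b ])
    split-at {M₁ = M₁} eq = FreeWalk-++⁻ (a ∷ M₁) (subst (FreeWalk H ∘ (a ∷_)) (snoc-split eq) P-free)

    split-at₂ : mid ≡ M₁ ++ u ∷ S ++ v ∷ M₂ →
                FreeWalk H (a ∷ M₁ ++ [ u ]) × FreeWalk H (u ∷ S ++ [ v ]) × FreeWalk H (v ∷ M₂ ++ [ b ])
    split-at₂ {u = u} {S = S} eq with split-at eq
    ... | pre , post with FreeWalk-++⁻ (u ∷ S) (subst (FreeWalk H ∘ (u ∷_)) (snoc-split {M₁ = S} refl) post)
    ... | segment , post′ = pre , segment , post′

    segment-unique : mid ≡ M₁ ++ u ∷ S ++ v ∷ M₂ → Unique (u ∷ S ++ [ v ])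
    segment-unique {M₁ = M₁} {u = u} {S = S} {v = v} {M₂ = M₂} eq =
      Unique-++⁻ˡ (u ∷ S ++ [ v ]) (subst Unique (cong (u ∷_) (sym (++-assoc S [ v ] (M₂ ++ [ b ]))))
        (Unique-++⁻ʳ (a ∷ M₁) (subst Unique (cong (a ∷_) (snoc-split₂ eq)) P-unique)))

    segment-⊆ : mid ≡ M₁ ++ u ∷ S ++ v ∷ M₂ → x ∈ u ∷ S ++ [ v ] → x ∈ mid
    segment-⊆ {M₁ = M₁} {u = u} {S = S} {v = v} {M₂ = M₂} {x = x} eq x∈ =
      subst (x ∈_) (sym eq) (∈-++⁺ʳ M₁ (subst (x ∈_) (cong (u ∷_) (++-assoc S [ v ] M₂)) (∈-++⁺ˡ x∈)))

    -- The edge x y yields a walk from a to x and one from x to b; neither may be shorter than P.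
    old-neighbour : Exposed H x → Adj G x y → mid ≡ M₁ ++ y ∷ M₂ → (x ≢ a → M₂ ≡ []) × (x ≢ b → M₁ ≡ [])
    old-neighbour {x = x} {y = y} {M₁ = M₁} {M₂ = M₂} (x∈H , x-free) xy eq =
      (λ x≢a → prefix-length-≤ M₁ (bound (shortest-walk a∈H x∈H (x≢a ∘ sym) (∈-++⁺ʳ M₁ (there (here refl)))
                 (FreeWalk-++⁺ (a ∷ M₁) (proj₁ (split-at eq))
                   (free-edge (new-edge (adj-sym G xy) (inj₁ y-new)) y-free x-free))))) ,
      (λ x≢b → ++-length-≤ M₁ (bound (shortest-walk x∈H b∈H x≢b (there (∈-++⁺ʳ M₂ (here refl)))
                 (FreeWalk-++⁺ [ x ] (free-edge (new-edge xy (inj₂ y-new)) x-free y-free) (proj₂ (split-at eq))))))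
      where
        y∈mid : y ∈ mid
        y∈mid = subst (y ∈_) (sym eq) (∈-++⁺ʳ M₁ (here refl))
        y-new : ¬ VH H y
        y-new = mid-new-at y∈mid
        y-free : ¬ Zset G H y
        y-free = P-free-at (mid⊆P y∈mid)
        bound : ∀ {k} → length (mid ++ [ b ]) ≤ k → length (M₁ ++ y ∷ M₂ ++ [ b ]) ≤ k
        bound = subst (_≤ _) (cong length (snoc-split eq))

    bridge : mid ≡ M₁ ++ u ∷ S ++ v ∷ M₂ → FreeWalk H (u ∷ T ++ [ v ]) → length S ≤ length T
    bridge {M₁ = M₁} {u = u} {S = S} {v = v} {M₂ = M₂} {T = T} eq walk with split-at₂ eq
    ... | pre , _ , post =
      infix-length-≤ {M₁ = S} {zs = v ∷ M₂ ++ [ b ]} {M₂ = T} M₁ (subst (_≤ _) (cong length (snoc-split₂ eq))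
        (shortest-walk a∈H b∈H a≢b (∈-++⁺ʳ M₁ (there (∈-++⁺ʳ T (there (∈-++⁺ʳ M₂ (here refl))))))
          (FreeWalk-++⁺ (a ∷ M₁) pre (FreeWalk-++⁺ (u ∷ T) walk post))))

    mid-edge : x ∈ mid → y ∈ mid → Adj G x y → FreeWalk H (x ∷ [ y ])
    mid-edge x∈ y∈ xy = free-edge (new-edge xy (inj₁ (mid-new-at x∈))) (P-free-at (mid⊆P x∈)) (P-free-at (mid⊆P y∈))

    consecutive : mid ≡ M₁ ++ u ∷ S ++ v ∷ M₂ → length S ≤ 0 → Consec P u v
    consecutive {M₁ = M₁} {S = []} {M₂ = M₂} eq _ = a ∷ M₁ , M₂ ++ [ b ] , cong (a ∷_) (snoc-split eq)

    mid-adjacent : x ∈ mid → y ∈ mid → Adj G x y → Consec P x y ⊎ Consec P y x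
    mid-adjacent x∈ y∈ xy with ∈-∃++₂ x∈ y∈ (Adj⇒≢ xy)
    ... | inj₁ (_ , _ , _ , eq) = inj₁ (consecutive eq (bridge {T = []} eq (mid-edge x∈ y∈ xy)))
    ... | inj₂ (_ , _ , _ , eq) = inj₂ (consecutive eq (bridge {T = []} eq (mid-edge y∈ x∈ (adj-sym G xy))))

    old-new-chord : VH H x → y ∈ mid → NewEdge H₂ x y → ⊥
    old-new-chord {x = x} {y = y} x∈H y∈mid (xy , ¬e) = split (∈-∃++ y∈mid)
      where
        x-free : ¬ Zset G H x
        x-free z = Zset⇒¬¬Yset x∈H z λ x∈Y →
          P-free-at (mid⊆P y∈mid) (Yset-neighbour x∈Y xy (mid-new-at y∈mid))
        first-edge : mid ≡ M₁ ++ y ∷ M₂ → M₁ ≡ [] → Consec P a y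
        first-edge {M₂ = M₂} eq refl = [] , M₂ ++ [ b ] , cong (a ∷_) (snoc-split {M₁ = []} eq)
        last-edge : mid ≡ M₁ ++ y ∷ M₂ → M₂ ≡ [] → Consec P y b
        last-edge {M₁ = M₁} eq refl = a ∷ M₁ , [] , cong (a ∷_) (snoc-split eq)
        split : (∃₂ λ M₁ M₂ → mid ≡ M₁ ++ y ∷ M₂) → ⊥
        split (M₁ , M₂ , eq) with old-neighbour (x∈H , x-free) xy eq | x ≟ a | x ≟ b
        ... | _     , M₁≡[] | yes refl | _        = ¬e (P-edge (first-edge {M₂ = M₂} eq (M₁≡[] a≢b)))
        ... | M₂≡[] , _     | no x≢a   | yes refl = ¬e (EH-sym (P-edge (last-edge {M₁ = M₁} eq (M₂≡[] x≢a))))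
        ... | M₂≡[] , M₁≡[] | no x≢a   | no x≢b   =
          no-claw (mid-new-at y∈mid) (P-free-at (mid⊆P y∈mid))
            (claw a b x a≢b (x≢a ∘ sym) (x≢b ∘ sym)
              ((a∈H , P-free-at (here refl)) , adj-sym G (proj₁ (P-new-edge (first-edge {M₂ = M₂} eq (M₁≡[] x≢b)))))
              ((b∈H , P-free-at b∈P) , proj₁ (P-new-edge (last-edge {M₁ = M₁} eq (M₂≡[] x≢a))))
              ((x∈H , x-free) , adj-sym G xy))

    -- A chord of H would be a one-edge H-path, so P is a single edge, and by uniqueness of
    -- chords it is the edge x y.
    old-chord : Chord H x y → ¬ EH H₂ x y → ⊥
    old-chord {x = x} {y = y} ch@(x∈H , y∈H , e) ¬e = chord-unique ch ab-chord not-ab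
      where
        mid≡[] : mid ≡ []
        mid≡[] = ∷ʳ-length-≤1 mid (shortest-walk x∈H y∈H (Adj⇒≢ (proj₁ e)) (here refl)
                   (free-edge e (chord-exposed ch) (chord-exposed (Chord-sym ch))))
        ab : Consec P a b
        ab = [] , [] , cong (λ m → a ∷ m ++ [ b ]) mid≡[]
        ab-chord : Chord H a b
        ab-chord = a∈H , b∈H , P-new-edge ab
        not-ab : ¬ SameEdge x y a b
        not-ab (inj₁ (x≡a , y≡b)) = ¬e (subst₂ (EH H₂) (sym x≡a) (sym y≡b) (P-edge ab))
        not-ab (inj₂ (x≡b , y≡a)) = ¬e (subst₂ (EH H₂) (sym x≡b) (sym y≡a) (EH-sym (P-edge ab)))

    chordless : ¬ Chord H₂ x y
    chordless (x∈ , y∈ , e) with vertex-kind x∈ | vertex-kind y∈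
    ... | inj₂ x∈mid | inj₂ y∈mid =
      [ proj₂ e ∘ P-edge , proj₂ e ∘ EH-sym ∘ P-edge ]′ (mid-adjacent x∈mid y∈mid (proj₁ e))
    ... | inj₁ x∈H   | inj₂ y∈mid = old-new-chord x∈H y∈mid e
    ... | inj₂ x∈mid | inj₁ y∈H   = old-new-chord y∈H x∈mid (adj-sym G (proj₁ e) , proj₂ e ∘ EH-sym)
    ... | inj₁ x∈H   | inj₁ y∈H   = old-chord (x∈H , y∈H , proj₁ e , proj₂ e ∘ EH-mono H⊑H₂) (proj₂ e)

    leaf-kind : ExposedNeighbour H₂ w t → ExposedNeighbour H w t ⊎ (t ∈ mid × Adj G w t)
    leaf-kind ((t∈ , t-free) , wt) with vertex-kind t∈
    ... | inj₁ t∈H   = inj₁ ((t∈H , t-free ∘ Zset-H₂) , wt)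
    ... | inj₂ t∈mid = inj₂ (t∈mid , wt)

    -- On an ear of length 2, t is a third H₂-neighbour of a, so t lies in Y(H₂).
    hidden-if-short : length (mid ++ [ b ]) ≤ 2 → t ∈ mid → ¬ Exposed H₂ t
    hidden-if-short {t = t} short t∈mid (_ , t-free) = two-neighbours a∈H λ (u₁ , u₂ , u₁≢u₂ , e₁ , e₂) →
      t-free (Yset⇒Zset (a ,
        (u₁ , u₂ , t , u₁≢u₂ , old≢t e₁ , old≢t e₂ , EH-mono H⊑H₂ e₁ , EH-mono H⊑H₂ e₂ , at) ,
        step (VH-mono H⊑H₂ a∈H) at (here (VH-∷ʳ⁺ {H = H} (mid⊆P t∈mid)))))
      where
        at : EH H₂ a t
        at = P-edge ([] , [ b ] , cong (λ m → a ∷ m ++ [ b ]) (∷ʳ-length-≤2 mid short t∈mid))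
        old≢t : EH H a u → u ≢ t
        old≢t e u≡t = mid-new-at t∈mid (subst (VH H) u≡t (proj₂ (EH⇒VH e)))

    -- Replacing the stretch of P between u and v by u w v would shorten P, as by girth that
    -- stretch has two inner vertices.
    two-new-leaves : w ∉ P → ¬ VH H w → ¬ Zset G H w → mid ≡ M₁ ++ u ∷ S ++ v ∷ M₂ →
                     Adj G w u → Adj G w v → ⊥
    two-new-leaves {w = w} {u = u} {S = S} {v = v} w∉P w∉H w-free eq wu wv with split-at₂ eq
    ... | _ , (segment , segment-free) , _ =
      <⇒≱ (girth-arc S (girth _ cycle))
          (bridge {T = [ w ]} eq (detour w∉H (All.head segment-free) w-free
                                   (All.lookup segment-free (∈-++⁺ʳ (u ∷ S) (here refl))) wu wv))
      where
        cycle : IsCycle G (closed (u ∷ S ++ v ∷ [ w ]))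
        cycle = path-cycle (segment-unique eq) (Linked.map proj₁ segment) ([] ∷ [])
                  (λ { (here refl) w∈ → w∉P (mid⊆P (segment-⊆ eq w∈)) })
                  (adj-sym G wv ∷ wu ∷ [-]) (length-++-≤ʳ (v ∷ [ w ]) {S})

    no-claw₂ : ¬ VH H₂ w → ¬ Zset G H₂ w → ¬ Claw H₂ w
    no-claw₂ {w = w} w∉ w-free cl with claw-split leaf-kind cl
    ... | inj₁ (_ , _ , l₁≢l₂ , e₁ , e₂) = no-claw w∉H w-free′ (claw-map old cl)
      where
        w∉H : ¬ VH H w
        w∉H = w∉ ∘ VH-mono H⊑H₂
        w-free′ : ¬ Zset G H w
        w-free′ = w-free ∘ Zset-H₂
        short : length (mid ++ [ b ]) ≤ 2
        short = shortest-walk (proj₁ (proj₁ e₁)) (proj₁ (proj₁ e₂)) l₁≢l₂ (there (here refl))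
                  (detour w∉H (proj₂ (proj₁ e₁)) w-free′ (proj₂ (proj₁ e₂)) (proj₂ e₁) (proj₂ e₂))
        old : ExposedNeighbour H₂ w t → ExposedNeighbour H w t
        old e with leaf-kind e
        ... | inj₁ e′          = e′
        ... | inj₂ (t∈mid , _) = ⊥-elim (hidden-if-short short t∈mid (proj₁ e))
    ... | inj₂ (_ , _ , l₁≢l₂ , (l₁∈ , wl₁) , (l₂∈ , wl₂)) with ∈-∃++₂ l₁∈ l₂∈ l₁≢l₂
    ...   | inj₁ (_ , _ , _ , eq) =
      two-new-leaves (w∉ ∘ VH-∷ʳ⁺ {H = H}) (w∉ ∘ VH-mono H⊑H₂) (w-free ∘ Zset-H₂) eq wl₁ wl₂
    ...   | inj₂ (_ , _ , _ , eq) =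
      two-new-leaves (w∉ ∘ VH-∷ʳ⁺ {H = H}) (w∉ ∘ VH-mono H⊑H₂) (w-free ∘ Zset-H₂) eq wl₂ wl₁

    mid-neighbours : v ∈ mid → TwoNeighbours H₂ v
    mid-neighbours {v = v} v∈ with ∈-∃++ v∈
    ... | M₁ , M₂ , eq with ∷ʳ-cons {b = b} M₂
    ... | s , R , eq′ = neighbours (cong (a ∷_) (trans (snoc-split eq) (cong (λ L → M₁ ++ v ∷ L) eq′)))
      where
        neighbours : P ≡ a ∷ M₁ ++ v ∷ s ∷ R → TwoNeighbours H₂ v
        neighbours P≡ with inner-neighbours a M₁ (subst Unique P≡ P-unique)
        ... | p , p≢s , pv , vs =
          p , s , p≢s , EH-sym (P-edge (subst (λ L → Consec L p v) (sym P≡) pv)) ,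
          P-edge (subst (λ L → Consec L v s) (sym P≡) vs)

    two-neighbours₂ : VH H₂ v → ¬ ¬ TwoNeighbours H₂ v
    two-neighbours₂ v∈ with vertex-kind v∈
    ... | inj₁ v∈H   = λ k → two-neighbours v∈H λ (p , s , p≢s , e , e′) →
                         k (p , s , p≢s , EH-mono H⊑H₂ e , EH-mono H⊑H₂ e′)
    ... | inj₂ v∈mid = λ k → k (mid-neighbours v∈mid)

    tame₂ : Tame H₂
    tame₂ = record
      { two-neighbours = two-neighbours₂
      ; no-claw        = no-claw₂
      ; chord-exposed  = λ ch → ⊥-elim (chordless ch)
      ; chord-unique   = λ ch _ _ → chordless ch
      }

  tame-ear : GirthAtLeast G 5 → Tame H → Shortest (IsHPath G (Zset G H) H) ear → Tame (H ++ [ ear ])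
  tame-ear girth tame ((((u , adj , _) , free) , (a , b , mid , refl , a∈ , b∈ , new) , ¬e) , shortest) =
    Ear.tame₂ girth tame u (Consec⇒Linked _ (λ x y c → adj x y c , ¬e x y c) , free) a∈ b∈ new shortest

  -- Adding the first ear of a stage

  MeetsOnlyAt : Pieces → List (Fin n) → Fin n → Set
  MeetsOnlyAt H C c = c ∈ C × VH H c × (∀ v → v ∈ C → VH H v → v ≡ c)

  -- What condition (B) provides in either of its two cases.
  record FirstEarView (H : Pieces) (C : List (Fin n)) : Set where
    field
      cycle       : IsCycleAvoid G (Zset G H) C
      shortest    : ∀ C′ → IsCycleAvoid G (Zset G H) C′ → (∀ {v} → v ∈ C′ → VH H v → v ∈ C) →
                    (∀ {c} → MeetsOnlyAt H C c → c ∈ C′) → len C ≤ len C′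
      no-one-meet : (∀ {v} → v ∈ C → ¬ VH H v) → ¬ Σ (List (Fin n)) (OneMeetCycle G (Zset G H) H)

  first-ear-view : ∀ {C} → FirstEar G H C → ¬ ¬ FirstEarView H C
  first-ear-view {H = H} {C = C} (if-meet , if-none) k = k (none-view (k ∘ meet-view))
    where
      meet-view : Σ (List (Fin n)) (OneMeetCycle G (Zset G H) H) → FirstEarView H C
      meet-view om with if-meet om
      ... | (cycle , c₀ , c₀∈ , c₀∈H , only) , shortest = record
        { cycle       = cycle
        ; shortest    = λ C′ cycle′ old⊆C meet∈ →
            shortest C′ (cycle′ , c₀ , meet∈ (c₀∈ , c₀∈H , only) , c₀∈H ,
                         λ v v∈ v∈H → only v (old⊆C v∈ v∈H) v∈H)
        ; no-one-meet = λ new _ → new c₀∈ c₀∈H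
        }
      none-view : ¬ Σ (List (Fin n)) (OneMeetCycle G (Zset G H) H) → FirstEarView H C
      none-view none with if-none none
      ... | cycle , shortest = record
        { cycle       = cycle
        ; shortest    = λ C′ cycle′ _ _ → shortest C′ cycle′
        ; no-one-meet = λ _ → none
        }

  record Competitor (H : Pieces) (C C′ : List (Fin n)) : Set where
    field
      cycle : IsCycleAvoid G (Zset G H) C′
      old⊆C : ∀ {v} → v ∈ C′ → VH H v → v ∈ C
      shorter : len C′ < len C

  -- One of the competitors contains the vertex where C meets H, if there is one.
  no-covering-competitors : ∀ {C C₁ C₂} → FirstEarView H C → Competitor H C C₁ → Competitor H C C₂ →
                            (∀ {v} → v ∈ C → v ∈ C₁ ⊎ v ∈ C₂) → ⊥
  no-covering-competitors {H = H} {C = C} {C₁ = C₁} {C₂ = C₂} view c₁ c₂ cover = no-meet meets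
    where
      open FirstEarView view
      beaten : ∀ {C′} → Competitor H C C′ → (∀ {c} → MeetsOnlyAt H C c → c ∈ C′) → ⊥
      beaten c meet∈ = <⇒≱ (Competitor.shorter c) (shortest _ (Competitor.cycle c) (Competitor.old⊆C c) meet∈)
      no-meet : ¬ Σ (Fin n) (MeetsOnlyAt H C) → ⊥
      no-meet none = beaten c₁ λ m → ⊥-elim (none (_ , m))
      meets : Σ (Fin n) (MeetsOnlyAt H C) → ⊥
      meets (c₀ , c₀∈ , _ , only) with cover c₀∈
      ... | inj₁ c₀∈C₁ = beaten c₁ λ (c∈ , c∈H , _) → subst (_∈ C₁) (sym (only _ c∈ c∈H)) c₀∈C₁
      ... | inj₂ c₀∈C₂ = beaten c₂ λ (c∈ , c∈H , _) → subst (_∈ C₂) (sym (only _ c∈ c∈H)) c₀∈C₂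

  module CycleStep (girth : GirthAtLeast G 5) {H : Pieces} (tame : Tame H)
                   (no-hpath : ¬ Σ (List (Fin n)) (IsHPath G (Zset G H) H))
                   {v₀ : Fin n} {zs : List (Fin n)}
                   (r-unique : Unique (v₀ ∷ zs)) (r-long : 2 ≤ length zs)
                   (r-linked : Linked (Adj G) (closed (v₀ ∷ zs)))
                   (r-free : All (λ v → ¬ Zset G H v) (v₀ ∷ zs))
                   (view : FirstEarView H (closed (v₀ ∷ zs)))
                   where

    open Tame tame

    r : List (Fin n)
    r = v₀ ∷ zs

    C : List (Fin n)
    C = closed r

    H₂ : Pieces
    H₂ = H ++ [ C ]

    H⊑H₂ : H ⊑ H₂
    H⊑H₂ = xs⊆xs++ys H [ C ]

    r-free-at : v ∈ r → ¬ Zset G H v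
    r-free-at = All.lookup r-free

    C-edge : Consec C x y → EH H₂ x y
    C-edge = EH-∷ʳ⁺ {H = H}

    vertex-kind : VH H₂ v → VH H v ⊎ v ∈ r
    vertex-kind v∈ with VH-∷ʳ⁻ {H = H} v∈
    ... | inj₁ v∈H = inj₁ v∈H
    ... | inj₂ v∈C = inj₂ (∈-closed⁻ v∈C)

    Zset-H₂ : Zset G H v → Zset G H₂ v
    Zset-H₂ = Zset-mono H⊑H₂ fresh
      where
        fresh : VH H₂ v → ¬ VH H v → ¬ Zset G H v
        fresh v∈ v∉ = [ ⊥-elim ∘ v∉ , r-free-at ]′ (vertex-kind v∈)

    no-free-walk : VH H x → VH H y → x ≢ y → y ∈ ws → FreeWalk H (x ∷ ws) → ⊥
    no-free-walk x∈ y∈ x≢y y∈ws walk with hpath-in-walk x∈ y∈ x≢y y∈ws walk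
    ... | Q , Q-hpath , _ = no-hpath (Q , Q-hpath)

    no-old-chord : ¬ Chord H x y
    no-old-chord ch@(x∈ , y∈ , e) =
      no-free-walk x∈ y∈ (Adj⇒≢ (proj₁ e)) (here refl)
        (free-edge e (chord-exposed ch) (chord-exposed (Chord-sym ch)))

    record Bridge (x y : Fin n) (T : List (Fin n)) : Set where
      field
        unique   : Unique T
        off-ring : ∀ {t} → t ∈ T → t ∉ r
        new      : All (λ t → ¬ VH H t) T
        free     : All (λ t → ¬ Zset G H t) T
        linked   : Linked (Adj G) (y ∷ T ++ [ x ])

    edge-bridge : Adj G y x → Bridge x y []
    edge-bridge yx = record { unique = [] ; off-ring = λ () ; new = [] ; free = [] ; linked = yx ∷ [-] }

    vertex-bridge : w ∉ r → ¬ VH H w → ¬ Zset G H w → Adj G w y → Adj G w x → Bridge x y [ w ]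
    vertex-bridge w∉r w∉H w-free wy wx = record
      { unique = [] ∷ [] ; off-ring = λ { (here refl) → w∉r } ; new = w∉H ∷ [] ; free = w-free ∷ []
      ; linked = adj-sym G wy ∷ wx ∷ [-] }

    module _ {x y : Fin n} (α : Arcs r x y) {T : List (Fin n)} (β : Bridge x y T) where
      open Arcs α
      open Bridge β

      arc-split : v ∈ closed (x ∷ inner₁ ++ y ∷ T) → v ∈ x ∷ inner₁ ++ [ y ] ⊎ v ∈ T
      arc-split v∈ = ∈-++-∷⁻ (x ∷ inner₁) (∈-closed⁻ v∈)

      arc-cycle : 2 ≤ length (inner₁ ++ y ∷ T) → IsCycle G (closed (x ∷ inner₁ ++ y ∷ T))
      arc-cycle = path-cycle (arc-unique α r-unique) (arc-linked α r-linked) unique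
                    (λ t∈ t∈arc → off-ring t∈ (arc-⊆ α t∈arc)) linked

      arc-competitor : 2 ≤ length (inner₁ ++ y ∷ T) → length T < length inner₂ →
                       Competitor H C (closed (x ∷ inner₁ ++ y ∷ T))
      arc-competitor 2≤ lt = record
        { cycle   = arc-cycle 2≤ ,
                    All.tabulate λ v∈ → [ r-free-at ∘ arc-⊆ α , All.lookup free ]′ (arc-split v∈)
        ; old⊆C   = λ v∈ v∈H →
                    [ ∈-closed⁺ ∘ arc-⊆ α , (λ v∈T → ⊥-elim (All.lookup new v∈T v∈H)) ]′ (arc-split v∈)
        ; shorter = subst₂ _<_ (sym (len-closed (inner₁ ++ y ∷ T))) (sym (trans (len-closed zs) (arcs-length α)))
                      (arc-shorter {ys = T} {zs = inner₂} {x = x} {y = y} inner₁ lt)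
        }

    competitors-cover : (α : Arcs r x y) → v ∈ C →
                        v ∈ closed (x ∷ Arcs.inner₁ α ++ y ∷ T) ⊎ v ∈ closed (y ∷ Arcs.inner₂ α ++ x ∷ T′)
    competitors-cover α v∈ with arcs-cover α (∈-closed⁻ v∈)
    ... | inj₁ v∈₁ = inj₁ (∈-closed⁺ (∈-++⁺ˡ v∈₁))
    ... | inj₂ v∈₂ = inj₂ (∈-closed⁺ (∈-++⁺ˡ v∈₂))

    ring-chord : x ∈ r → y ∈ r → Adj G x y → ¬ Consec C x y → ¬ Consec C y x → ⊥
    ring-chord {x = x} {y = y} x∈ y∈ xy ¬xy ¬yx with find-arcs x∈ y∈ (Adj⇒≢ xy)
    ... | arcs [] S₂ rot = ¬xy (rotation-Consec rot ([] , S₂ ++ [ x ] , refl))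
    ... | arcs S₁@(_ ∷ _) [] rot =
      ¬yx (rotation-Consec rot (x ∷ S₁ , [] , cong (x ∷_) (++-assoc S₁ [ y ] [ x ])))
    ... | α@(arcs (s₁ ∷ S₁) (s₂ ∷ S₂) _) =
      no-covering-competitors view
        (arc-competitor α (edge-bridge (adj-sym G xy)) (2≤length {a = s₁} S₁) (s≤s z≤n))
        (arc-competitor (arcs-swap α) (edge-bridge xy) (2≤length {a = s₂} S₂) (s≤s z≤n))
        (competitors-cover α)

    -- By girth both arcs have two inner vertices, so both competitors are shorter than C.
    ring-claw : w ∉ r → ¬ VH H w → ¬ Zset G H w → x ∈ r → y ∈ r → x ≢ y → Adj G w x → Adj G w y → ⊥
    ring-claw {w = w} {x = x} {y = y} w∉r w∉H w-free x∈ y∈ x≢y wx wy with find-arcs x∈ y∈ x≢y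
    ... | α@(arcs S₁ S₂ _) =
      no-covering-competitors view
        (arc-competitor α β₁ 2≤₁ (girth-arc S₂ (girth _ (arc-cycle (arcs-swap α) β₂ 2≤₂))))
        (arc-competitor (arcs-swap α) β₂ 2≤₂ (girth-arc S₁ (girth _ (arc-cycle α β₁ 2≤₁))))
        (competitors-cover α)
      where
        β₁ : Bridge x y [ w ]
        β₁ = vertex-bridge w∉r w∉H w-free wy wx
        β₂ : Bridge y x [ w ]
        β₂ = vertex-bridge w∉r w∉H w-free wx wy
        2≤₁ : 2 ≤ length (S₁ ++ y ∷ [ w ])
        2≤₁ = length-++-≤ʳ (y ∷ [ w ]) {S₁}
        2≤₂ : 2 ≤ length (S₂ ++ x ∷ [ w ])
        2≤₂ = length-++-≤ʳ (x ∷ [ w ]) {S₂}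

    ring-degree≤2 : a ≢ b → a ≢ c → b ≢ c → (Consec C s a ⊎ Consec C a s) →
                    (Consec C s b ⊎ Consec C b s) → (Consec C s c ⊎ Consec C c s) → ⊥
    ring-degree≤2 a≢b a≢c b≢c sa sb sc with pigeonhole₃ a≢b a≢c b≢c sa sb sc
    ... | inj₁ (_ , _ , p≢q , sp , sq) = p≢q (successor-unique r r-unique sp sq)
    ... | inj₂ (_ , _ , p≢q , ps , qs) =
      p≢q (predecessor-unique (zs ++ [ v₀ ]) (Unique-++-comm [ v₀ ] r-unique) ps qs)

    record Attachment (x y : Fin n) : Set where
      field
        old      : VH H x
        off-ring : x ∉ r
        on-ring  : y ∈ r
        new      : ¬ VH H y
        edge     : Adj G x y

    old-vertex : VH H₂ v → v ∉ r → VH H v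
    old-vertex v∈ v∉r = [ (λ v∈H → v∈H) , ⊥-elim ∘ v∉r ]′ (vertex-kind v∈)

    chord-attachment : Chord H₂ x y → Attachment x y ⊎ Attachment y x
    chord-attachment {x = x} {y = y} (x∈ , y∈ , xy , ¬e) with any? (x ≟_) r | any? (y ≟_) r
    ... | yes x∈r | yes y∈r = ⊥-elim (ring-chord x∈r y∈r xy (¬e ∘ C-edge) (¬e ∘ EH-sym ∘ C-edge))
    ... | no x∉r  | no y∉r  =
      ⊥-elim (no-old-chord (old-vertex x∈ x∉r , old-vertex y∈ y∉r , xy , ¬e ∘ EH-mono H⊑H₂))
    ... | no x∉r  | yes y∈r with VH? H y
    ...   | yes y∈H = ⊥-elim (no-old-chord (old-vertex x∈ x∉r , y∈H , xy , ¬e ∘ EH-mono H⊑H₂))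
    ...   | no y∉H  =
      inj₁ (record { old = old-vertex x∈ x∉r ; off-ring = x∉r ; on-ring = y∈r ; new = y∉H ; edge = xy })
    chord-attachment {x = x} {y = y} (x∈ , y∈ , xy , ¬e) | yes x∈r | no y∉r with VH? H x
    ...   | yes x∈H = ⊥-elim (no-old-chord (x∈H , old-vertex y∈ y∉r , xy , ¬e ∘ EH-mono H⊑H₂))
    ...   | no x∉H  =
      inj₂ (record { old = old-vertex y∈ y∉r ; off-ring = y∉r ; on-ring = x∈r ; new = x∉H ; edge = adj-sym G xy })

    module Attached {x y : Fin n} (att : Attachment x y) where
      open Attachment att

      root-free : ¬ Zset G H x
      root-free z = Zset⇒¬¬Yset old z λ x∈Y → r-free-at on-ring (Yset-neighbour x∈Y edge new)

      root-edge : FreeWalk H (x ∷ [ y ])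
      root-edge = free-edge (new-edge edge (inj₂ new)) root-free (r-free-at on-ring)

      -- Otherwise x y followed by C up to its first old vertex contains an H-path.
      ring-new : v ∈ r → ¬ VH H v
      ring-new {v = v} v∈r v∈H with ring-path on-ring v∈r r-linked
      ... | I , path , I⊆r with first-split (VH? H) (lose (∈-++⁺ʳ I (here refl)) v∈H)
      ... | J , c , K , eq , J-new , c∈H =
        no-free-walk old c∈H (λ x≡c → off-ring (subst (_∈ r) (sym x≡c) (on-path c∈)))
          (there (∈-++⁺ʳ J (here refl)))
          (FreeWalk-++⁺ [ x ] root-edge
            (new-linked (y ∷ J) (proj₁ (Linked-++⁻ (y ∷ J) (subst (Linked (Adj G) ∘ (y ∷_)) eq path)))
                        (new ∷ J-new) ,
             All.tabulate λ { (here refl) → r-free-at on-ring ; (there u∈) → r-free-at (on-path (prefix u∈)) }))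
        where
          on-path : u ∈ I ++ [ v ] → u ∈ r
          on-path u∈ = [ I⊆r , (λ { (here refl) → v∈r }) ]′ (∈-++⁻ I u∈)
          prefix : u ∈ J ++ [ c ] → u ∈ I ++ [ v ]
          prefix u∈ =
            subst (_ ∈_) (sym eq) ([ ∈-++⁺ˡ , (λ { (here refl) → ∈-++⁺ʳ J (here refl) }) ]′ (∈-++⁻ J u∈))
          c∈ : c ∈ I ++ [ v ]
          c∈ = prefix (∈-++⁺ʳ J (here refl))

      old-edge : VH H u → EH H₂ u w → EH H u w
      old-edge u∈H e with EH-∷ʳ⁻ {H = H} e
      ... | inj₁ e′ = e′
      ... | inj₂ c  = ⊥-elim (ring-new (∈-closed⁻ ([ proj₁ ∘ Consec-∈ , proj₂ ∘ Consec-∈ ]′ c)) u∈H)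

      old-walk : {k : ℕ} → VH H u → Walk (VH H₂) (EH H₂) k u w → Walk (VH H) (EH H) k u w
      old-walk u∈H (here _)     = here u∈H
      old-walk u∈H (step _ e k) = step u∈H (old-edge u∈H e) (old-walk (proj₂ (EH⇒VH (old-edge u∈H e))) k)

      ring-edge : ¬ VH H s → EH H₂ s a → Consec C s a ⊎ Consec C a s
      ring-edge s∉H e = [ ⊥-elim ∘ s∉H ∘ proj₁ ∘ EH⇒VH , (λ c → c) ]′ (EH-∷ʳ⁻ {H = H} e)

      Yset-H₂ : Yset H₂ v → Yset H v
      Yset-H₂ (s , (a₁ , a₂ , a₃ , d₁₂ , d₁₃ , d₂₃ , e₁ , e₂ , e₃) , k) with VH? H s
      ... | yes s∈H =
        s , (a₁ , a₂ , a₃ , d₁₂ , d₁₃ , d₂₃ , old-edge s∈H e₁ , old-edge s∈H e₂ , old-edge s∈H e₃) , old-walk s∈H k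
      ... | no s∉H  = ⊥-elim (ring-degree≤2 d₁₂ d₁₃ d₂₃ (ring-edge s∉H e₁) (ring-edge s∉H e₂) (ring-edge s∉H e₃))

      root-free₂ : ¬ Zset G H₂ x
      root-free₂ z = Zset⇒¬¬Yset (VH-mono H⊑H₂ old) z (root-free ∘ Yset⇒Zset ∘ Yset-H₂)

      leaf-free₂ : ¬ Zset G H₂ y
      leaf-free₂ z = Zset⇒¬¬Yset (VH-∷ʳ⁺ {H = H} (∈-closed⁺ on-ring)) z (new ∘ Yset⇒VH ∘ Yset-H₂)

      ring-walk : u ∈ r → Σ (List (Fin n)) λ I → FreeWalk H (y ∷ I ++ [ u ])
      ring-walk {u = u} u∈ with ring-path on-ring u∈ r-linked
      ... | I , path , I⊆r = I , new-linked (y ∷ I) path (All.tabulate (ring-new ∘ on-ring-path ∘ ∈-++⁺ˡ)) ,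
                                All.tabulate (r-free-at ∘ on-ring-path)
        where
          on-ring-path : v ∈ y ∷ I ++ [ u ] → v ∈ r
          on-ring-path (here refl) = on-ring
          on-ring-path (there v∈)  = [ I⊆r , (λ { (here refl) → u∈ }) ]′ (∈-++⁻ I v∈)

    two-roots : Attachment x y → Attachment x′ y′ → x′ ≢ x → ⊥
    two-roots {x = x} {y = y} {x′ = x′} {y′ = y′} att att′ x′≢x =
      via (Attached.ring-walk att (Attachment.on-ring att′))
      where
        via : Σ (List (Fin n)) (λ I → FreeWalk H (y ∷ I ++ [ y′ ])) → ⊥
        via (I , path) =
          no-free-walk (Attachment.old att) (Attachment.old att′) (x′≢x ∘ sym) (there (∈-++⁺ʳ I (there (here refl))))
            (FreeWalk-++⁺ [ x ] (Attached.root-edge att) (FreeWalk-++⁺ (y ∷ I) path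
              (free-edge (new-edge (adj-sym G (Attachment.edge att′)) (inj₁ (Attachment.new att′)))
                         (r-free-at (Attachment.on-ring att′)) (Attached.root-free att′))))

    one-root : Attachment x y → Attachment x y′ → y′ ≢ y → ⊥
    one-root {x = x} {y = y} {y′ = y′} att att′ y′≢y =
      FirstEarView.no-one-meet view (ring-new ∘ ∈-closed⁻) (_ , one-meet)
      where
        open Attached att
        α : Arcs r y y′
        α = find-arcs (Attachment.on-ring att) (Attachment.on-ring att′) (y′≢y ∘ sym)
        cycle : IsCycle G (closed (y ∷ Arcs.inner₁ α ++ y′ ∷ [ x ]))
        cycle = path-cycle (arc-unique α r-unique) (arc-linked α r-linked) ([] ∷ [])
          (λ { (here refl) x∈ → Attachment.off-ring att (arc-⊆ α x∈) })
          (adj-sym G (Attachment.edge att′) ∷ Attachment.edge att ∷ [-])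
          (length-++-≤ʳ (y′ ∷ [ x ]) {Arcs.inner₁ α})
        on-cycle : v ∈ closed (y ∷ Arcs.inner₁ α ++ y′ ∷ [ x ]) → v ∈ r ⊎ v ≡ x
        on-cycle v∈ =
          [ inj₁ ∘ arc-⊆ α , (λ { (here refl) → inj₂ refl }) ]′ (∈-++-∷⁻ (y ∷ Arcs.inner₁ α) (∈-closed⁻ v∈))
        one-meet : OneMeetCycle G (Zset G H) H (closed (y ∷ Arcs.inner₁ α ++ y′ ∷ [ x ]))
        one-meet =
          (cycle , All.tabulate λ v∈ → [ r-free-at , (λ { refl → root-free }) ]′ (on-cycle v∈)) ,
          x , ∈-closed⁺ (∈-++⁺ʳ (y ∷ Arcs.inner₁ α) (there (here refl))) , Attachment.old att ,
          λ v v∈ v∈H → [ (λ v∈r → ⊥-elim (ring-new v∈r v∈H)) , (λ v≡x → v≡x) ]′ (on-cycle v∈)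

    attachment-unique : Attachment x y → Attachment x′ y′ → x′ ≡ x × y′ ≡ y
    attachment-unique {x = x} {y = y} {x′ = x′} {y′ = y′} att att′ with x′ ≟ x | y′ ≟ y
    ... | no x′≢x  | _        = ⊥-elim (two-roots att att′ x′≢x)
    ... | yes x′≡x | yes y′≡y = x′≡x , y′≡y
    ... | yes x′≡x | no y′≢y  = ⊥-elim (one-root att (subst (λ z → Attachment z y′) x′≡x att′) y′≢y)

    leaf-kind : ExposedNeighbour H₂ w t → ExposedNeighbour H w t ⊎ (t ∈ r × Adj G w t)
    leaf-kind ((t∈ , t-free) , wt) with vertex-kind t∈
    ... | inj₁ t∈H = inj₁ ((t∈H , t-free ∘ Zset-H₂) , wt)
    ... | inj₂ t∈r = inj₂ (t∈r , wt)

    no-claw₂ : ¬ VH H₂ w → ¬ Zset G H₂ w → ¬ Claw H₂ w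
    no-claw₂ w∉ w-free cl with claw-split leaf-kind cl
    ... | inj₁ (_ , _ , l₁≢l₂ , ((l₁∈H , l₁-free) , wl₁) , ((l₂∈H , l₂-free) , wl₂)) =
      no-free-walk l₁∈H l₂∈H l₁≢l₂ (there (here refl))
        (detour (w∉ ∘ VH-mono H⊑H₂) l₁-free (w-free ∘ Zset-H₂) l₂-free wl₁ wl₂)
    ... | inj₂ (_ , _ , l₁≢l₂ , (l₁∈ , wl₁) , (l₂∈ , wl₂)) =
      ring-claw (w∉ ∘ VH-∷ʳ⁺ {H = H} ∘ ∈-closed⁺) (w∉ ∘ VH-mono H⊑H₂) (w-free ∘ Zset-H₂) l₁∈ l₂∈ l₁≢l₂ wl₁ wl₂

    two-neighbours₂ : VH H₂ v → ¬ ¬ TwoNeighbours H₂ v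
    two-neighbours₂ v∈ with vertex-kind v∈
    ... | inj₁ v∈H = λ k → two-neighbours v∈H λ (p , s , p≢s , e , e′) →
                       k (p , s , p≢s , EH-mono H⊑H₂ e , EH-mono H⊑H₂ e′)
    ... | inj₂ v∈r with ring-neighbours r-unique (s≤s r-long) v∈r
    ...   | s , p , s≢p , vs , pv = λ k → k (s , p , s≢p , C-edge vs , EH-sym (C-edge pv))

    chord-exposed₂ : Chord H₂ x y → ¬ Zset G H₂ x
    chord-exposed₂ ch with chord-attachment ch
    ... | inj₁ att = Attached.root-free₂ att
    ... | inj₂ att = Attached.leaf-free₂ att

    chord-unique₂ : Chord H₂ x y → Chord H₂ x′ y′ → ¬ ¬ SameEdge x y x′ y′
    chord-unique₂ ch ch′ k with chord-attachment ch | chord-attachment ch′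
    ... | inj₁ att | inj₁ att′ = let x′≡x , y′≡y = attachment-unique att att′ in k (inj₁ (sym x′≡x , sym y′≡y))
    ... | inj₁ att | inj₂ att′ = let y′≡x , x′≡y = attachment-unique att att′ in k (inj₂ (sym y′≡x , sym x′≡y))
    ... | inj₂ att | inj₁ att′ = let x′≡y , y′≡x = attachment-unique att att′ in k (inj₂ (sym y′≡x , sym x′≡y))
    ... | inj₂ att | inj₂ att′ = let y′≡y , x′≡x = attachment-unique att att′ in k (inj₁ (sym x′≡x , sym y′≡y))

    tame₂ : Tame H₂
    tame₂ = record
      { two-neighbours = two-neighbours₂
      ; no-claw        = no-claw₂
      ; chord-exposed  = chord-exposed₂
      ; chord-unique   = chord-unique₂
      }

  tame-first-ear : ∀ {C} → GirthAtLeast G 5 → Tame H → ¬ Σ (List (Fin n)) (IsHPath G (Zset G H) H) →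
                   FirstEarView H C → Tame (H ++ [ C ])
  tame-first-ear girth tame no-hpath view with FirstEarView.cycle view
  ... | (v₀ , zs , refl , unique , 2≤ , adj) , free =
    CycleStep.tame₂ girth tame no-hpath unique 2≤ (Consec⇒Linked _ adj) (Allₚ.++⁻ˡ (v₀ ∷ zs) free) view

  tame-cycle : ∀ {C} → GirthAtLeast G 5 → Tame H → ¬ Σ (List (Fin n)) (IsHPath G (Zset G H) H) →
               FirstEar G H C → Tame (H ++ [ C ])
  tame-cycle girth tame no-hpath first =
    Tame-stable λ k → first-ear-view first (k ∘ tame-first-ear girth tame no-hpath)

  -- Coarse ear-decompositions

  tame-ears : GirthAtLeast G 5 → Tame H → ValidEars G H Ps → Tame (H ++ Ps)
  tame-ears {H = H} {Ps = []}     _     tame _                  = subst Tame (sym (++-identityʳ H)) tame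
  tame-ears {H = H} {Ps = P ∷ Ps} girth tame (shortest , valid) =
    subst Tame (++-assoc H [ P ] Ps) (tame-ears girth (tame-ear girth tame shortest) valid)

  tame-stages : GirthAtLeast G 5 → Tame H → ValidStages G H D → Tame (H ++ piecesOf D)
  tame-stages {H = H} {D = []}           _     tame _ = subst Tame (sym (++-identityʳ H)) tame
  tame-stages {H = H} {D = (C , Ps) ∷ D} girth tame (no-hpath , first , ears , rest) =
    subst Tame (++-assoc H (C ∷ Ps) (piecesOf D))
      (tame-stages girth
        (subst Tame (++-assoc H [ C ] Ps) (tame-ears girth (tame-cycle girth tame no-hpath first) ears)) rest)

  tame-decomposition : GirthAtLeast G 5 → IsCED G D → Tame (piecesOf D)
  tame-decomposition {D = _ ∷ _} girth ced = tame-stages girth tame-[] ced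

  1≤len : ∀ (Q : List (Fin n)) → 2 ≤ length Q → 1 ≤ len Q
  1≤len (_ ∷ _ ∷ _) _             = s≤s z≤n
  1≤len (_ ∷ [])    (s≤s ())

  ShortestEar : Pieces → List (Fin n) → Set
  ShortestEar H = Shortest (IsHPath G (Zset G H) H)

  chord-ear : Tame H → Chord H x y → ShortestEar H (x ∷ [ y ])
  chord-ear tame ch@(x∈ , y∈ , xy , ¬e) =
    (((((Adj⇒≢ xy ∷ []) ∷ [] ∷ []) , (λ _ _ → Linked⇒Consec (xy ∷ [-])) , s≤s (s≤s z≤n)) ,
      Tame.chord-exposed tame ch ∷ Tame.chord-exposed tame (Chord-sym ch) ∷ []) ,
     (_ , _ , [] , refl , x∈ , y∈ , []) ,
     (λ _ _ → Linked⇒Consec (¬e ∷ [-]))) ,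
    λ { Q (((_ , _ , 2≤) , _) , _) → 1≤len Q 2≤ }

  appendEar : List (Stage {n}) → List (Fin n) → List (Stage {n})
  appendEar []                   _ = []
  appendEar ((C , Ps) ∷ [])      Q = (C , Ps ++ [ Q ]) ∷ []
  appendEar (stage ∷ stage′ ∷ D) Q = stage ∷ appendEar (stage′ ∷ D) Q

  piecesOf-appendEar : ∀ stage D (Q : List (Fin n)) →
                       piecesOf (appendEar (stage ∷ D) Q) ≡ piecesOf (stage ∷ D) ++ [ Q ]
  piecesOf-appendEar (C , Ps) []            Q =
    trans (++-identityʳ (C ∷ Ps ++ [ Q ])) (cong (_++ [ Q ]) (sym (++-identityʳ (C ∷ Ps))))
  piecesOf-appendEar (C , Ps) (stage′ ∷ D) Q =
    trans (cong ((C ∷ Ps) ++_) (piecesOf-appendEar stage′ D Q)) (sym (++-assoc (C ∷ Ps) _ [ Q ]))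

  ValidEars-∷ʳ : ∀ {Q} → ValidEars G H Ps → ShortestEar (H ++ Ps) Q → ValidEars G H (Ps ++ [ Q ])
  ValidEars-∷ʳ {H = H} {Ps = []}     _                  shortest =
    subst (λ K → ShortestEar K _) (++-identityʳ H) shortest , _
  ValidEars-∷ʳ {H = H} {Ps = P ∷ Ps} (shortest′ , valid) shortest =
    shortest′ , ValidEars-∷ʳ valid (subst (λ K → ShortestEar K _) (sym (++-assoc H [ P ] Ps)) shortest)

  ValidStages-appendEar : ∀ {stage Q} → ValidStages G H (stage ∷ D) → ShortestEar (H ++ piecesOf (stage ∷ D)) Q →
                          ValidStages G H (appendEar (stage ∷ D) Q)
  ValidStages-appendEar {H = H} {D = []} {stage = C , Ps} (no-hpath , first , ears , _) shortest =
    no-hpath , first ,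
    ValidEars-∷ʳ ears (subst (λ K → ShortestEar K _)
      (trans (cong (H ++_) (++-identityʳ (C ∷ Ps))) (sym (++-assoc H [ C ] Ps))) shortest) , _
  ValidStages-appendEar {H = H} {D = _ ∷ _} {stage = C , Ps} (no-hpath , first , ears , rest) shortest =
    no-hpath , first , ears ,
    ValidStages-appendEar rest (subst (λ K → ShortestEar K _) (sym (++-assoc H (C ∷ Ps) _)) shortest)

  extend-by-ear : ∀ {Q} → IsCED G D → ShortestEar (piecesOf D) Q →
                  Σ (List (Stage {n})) λ D′ → IsCED G D′ × piecesOf D′ ≡ piecesOf D ++ [ Q ]
  extend-by-ear {D = stage ∷ []} {Q} ced shortest =
    appendEar (stage ∷ []) Q , ValidStages-appendEar {D = []} ced shortest , piecesOf-appendEar stage [] Q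
  extend-by-ear {D = stage ∷ stage′ ∷ D} {Q} ced shortest =
    appendEar (stage ∷ stage′ ∷ D) Q , ValidStages-appendEar {D = stage′ ∷ D} ced shortest ,
    piecesOf-appendEar stage (stage′ ∷ D) Q

proposition3p4 : (n : ℕ) (G : Graph n) (D : List Stage) →
    GirthAtLeast G 5 → IsMaximalCED G D → Induced G (piecesOf D)
proposition3p4 n G D girth (ced , maximal) x y x∈ y∈ xy with EH? (piecesOf D) x y
... | yes e  = e
... | no ¬e with extend-by-ear G {D = D} ced (chord-ear G (tame-decomposition G {D = D} girth ced) (x∈ , y∈ , xy , ¬e))
... | D′ , ced′ , pieces≡ = ⊥-elim (maximal (D′ , ced′ , proper-edge-extension pieces≡ ¬e))
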